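{- Let $OABC$ be an integer multistory completely empty marked pyramid in $\mathbb R^3$ with vertex $O$ and triangular base $ABC$, where $ABC$ is integer-affine equivalent to the triangle with vertices $(2,0),(0,-1),(0,1)$. Then $OABC$ is two-story and integer-affine equivalent to the marked pyramid $U_2$ with vertex $(0,0,0)$ and base $(2,1,1),(2,2,-1),(2,0,-1)$.
   Context: Integer-affine equivalence of marked pyramids: affine automorphism of $\mathbb R^3$ preserving $\mathbb Z^3$ sending vertex to vertex; a base triangle is compared with a triangle of $\mathbb R^2$ via an affine isomorphism matching integer points. Completely empty: no integer points other than the vertex and the integer points of the base. $l$-story: integer distance from vertex to the base plane equals $l$ (Euclidean distance divided by the minimal nonzero Euclidean distance to the plane of integer points in the affine span of the plane and the vertex); multistory: $l>1$. -}

module Defs where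

open import Data.Nat using (ℕ; _<_; _≤_) renaming (_+_ to _+ℕ_; _*_ to _*ℕ_)
open import Data.Integer using (ℤ; +_; -_; _+_; _-_; _*_; ∣_∣; 0ℤ; 1ℤ)
open import Data.Product using (Σ; ∃; _×_; _,_)
open import Data.Sum using (_⊎_)
open import Data.List using (List; []; _∷_; map)
open import Data.List.Relation.Binary.Permutation.Propositional using (_↭_)
open import Relation.Binary.PropositionalEquality using (_≡_; _≢_)

record Pt : Set where
  constructor pt
  field
    px py pz : ℤ
open Pt public

record Pt2 : Set where
  constructor pt2
  field
    qx qy : ℤ
open Pt2 public

origin : Pt
origin = pt 0ℤ 0ℤ 0ℤ

infixl 6 _⊕_ _⊖_
infixl 7 _·_

_⊕_ : Pt → Pt → Pt
pt a b c ⊕ pt d e f = pt (a + d) (b + e) (c + f)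

_⊖_ : Pt → Pt → Pt
pt a b c ⊖ pt d e f = pt (a - d) (b - e) (c - f)

_·_ : ℤ → Pt → Pt
k · pt a b c = pt (k * a) (k * b) (k * c)

dot : Pt → Pt → ℤ
dot (pt a b c) (pt d e f) = a * d + b * e + c * f

cross : Pt → Pt → Pt
cross (pt a b c) (pt d e f) = pt (b * f - c * e) (c * d - a * f) (a * e - b * d)

det3 : Pt → Pt → Pt → ℤ
det3 u v w = dot u (cross v w)

IsPyramid : Pt → Pt → Pt → Pt → Set
IsPyramid O A B C = det3 (A ⊖ O) (B ⊖ O) (C ⊖ O) ≢ 0ℤ

-- P lies in the convex hull of O,A,B,C (rational barycentric coordinates,
-- denominators cleared: d·P = a0 O + a1 A + a2 B + a3 C, a_i ≥ 0, Σ a_i = d > 0)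
InConv4 : Pt → Pt → Pt → Pt → Pt → Set
InConv4 P O A B C =
  Σ ℕ λ d → Σ ℕ λ a0 → Σ ℕ λ a1 → Σ ℕ λ a2 → Σ ℕ λ a3 →
    (0 < d) × (a0 +ℕ a1 +ℕ a2 +ℕ a3 ≡ d) ×
    ((+ d) · P ≡ (+ a0) · O ⊕ (+ a1) · A ⊕ (+ a2) · B ⊕ (+ a3) · C)

InConv3 : Pt → Pt → Pt → Pt → Set
InConv3 P A B C =
  Σ ℕ λ d → Σ ℕ λ a1 → Σ ℕ λ a2 → Σ ℕ λ a3 →
    (0 < d) × (a1 +ℕ a2 +ℕ a3 ≡ d) ×
    ((+ d) · P ≡ (+ a1) · A ⊕ (+ a2) · B ⊕ (+ a3) · C)

CompletelyEmpty : Pt → Pt → Pt → Pt → Set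
CompletelyEmpty O A B C =
  ∀ (P : Pt) → InConv4 P O A B C → (P ≡ O) ⊎ InConv3 P A B C

-- Integer distance from O to the plane ABC equals l.
-- n is a nonzero integer normal vector of the plane ABC; the Euclidean
-- distance of an integer point x to the plane is ∣ n·(x - A) ∣ / |n|, so
-- the ratio of the distance of O to the minimal nonzero distance of integer
-- points is ∣ n·(O - A) ∣ / m with m the minimal positive ∣ n·(x - A) ∣.
IntDist : Pt → Pt → Pt → Pt → ℕ → Set
IntDist O A B C l =
  Σ Pt λ n → (n ≢ origin) × (dot n (B ⊖ A) ≡ 0ℤ) × (dot n (C ⊖ A) ≡ 0ℤ) ×
    Σ ℕ λ m → (0 < m) ×
      (Σ Pt λ x → ∣ dot n (x ⊖ A) ∣ ≡ m) ×
      (∀ (x : Pt) → 0 < ∣ dot n (x ⊖ A) ∣ → m ≤ ∣ dot n (x ⊖ A) ∣) ×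
      (∣ dot n (O ⊖ A) ∣ ≡ l *ℕ m)

Multistory : Pt → Pt → Pt → Pt → Set
Multistory O A B C = Σ ℕ λ l → (1 < l) × IntDist O A B C l

InPlane : Pt → Pt → Pt → Pt → Set
InPlane A B C x =
  Σ ℤ λ d → Σ ℤ λ s → Σ ℤ λ t →
    (d ≢ 0ℤ) × (d · (x ⊖ A) ≡ s · (B ⊖ A) ⊕ t · (C ⊖ A))

aff2 : Pt → Pt → Pt → Pt2 → Pt
aff2 p u v (pt2 s t) = p ⊕ s · u ⊕ t · v

-- Base triangle ABC is integer-affine equivalent to a triangle with
-- vertices a b c in ℝ²: an affine isomorphism ψ from ℝ² onto the plane of
-- ABC, mapping ℤ² onto the integer points of that plane, sending the vertex
-- set {a,b,c} to {A,B,C}.  (ψ(ℤ²) ⊆ ℤ³ forces ψ(0), ψ(e₁)-ψ(0), ψ(e₂)-ψ(0)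
-- to be integer vectors, so ψ is given by integer data p u v.)
TriEquiv : Pt → Pt → Pt → Pt2 → Pt2 → Pt2 → Set
TriEquiv A B C a b c =
  Σ Pt λ p → Σ Pt λ u → Σ Pt λ v →
    (cross u v ≢ origin) ×
    ((map (aff2 p u v) (a ∷ b ∷ c ∷ [])) ↭ (A ∷ B ∷ C ∷ [])) ×
    (∀ (x : Pt) → InPlane A B C x → Σ Pt2 λ y → aff2 p u v y ≡ x)

record Mat : Set where
  constructor mat
  field
    r1 r2 r3 : Pt

app : Mat → Pt → Pt
app (mat r1 r2 r3) x = pt (dot r1 x) (dot r2 x) (dot r3 x)

-- Integer-affine equivalence of marked pyramids: an affine automorphism
-- x ↦ M x + t of ℝ³ preserving ℤ³ (M integer with integer inverse N,
-- t integer) sending vertex O to O' and base {A,B,C} onto {A',B',C'}.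
PyrEquiv : Pt → Pt → Pt → Pt → Pt → Pt → Pt → Pt → Set
PyrEquiv O A B C O' A' B' C' =
  Σ Mat λ M → Σ Mat λ N → Σ Pt λ t →
    (∀ x → app M (app N x) ≡ x) × (∀ x → app N (app M x) ≡ x) ×
    (app M O ⊕ t ≡ O') ×
    (map (λ x → app M x ⊕ t) (A ∷ B ∷ C ∷ []) ↭ (A' ∷ B' ∷ C' ∷ []))

T-a T-b T-c : Pt2
T-a = pt2 (+ 2) 0ℤ
T-b = pt2 0ℤ (- 1ℤ)
T-c = pt2 0ℤ 1ℤ

U2-O U2-A U2-B U2-C : Pt
U2-O = pt 0ℤ 0ℤ 0ℤ
U2-A = pt (+ 2) 1ℤ 1ℤ
U2-B = pt (+ 2) (+ 2) (- 1ℤ)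
U2-C = pt (+ 2) 0ℤ (- 1ℤ)

{-# OPTIONS --safe #-}
-- In a lattice basis adapted to the pyramid (the isomorphism ψ of ℤ² onto the lattice points of the
-- base plane given by the triangle equivalence, together with a lattice vector w one step above that
-- plane) the base is the triangle T = (2,0), (0,−1), (0,1) at level 0 and the apex is (α, β, l).
-- Write α = x l − a and β = y l − r with 0 ≤ a, r < l.  The lattice point (x, y, 1) or (x, y − 1, 1)
-- lies in the pyramid unless a = l − 1 and l = 2r, and then (2x − 1, 2y − 1, 2) lies in it unless
-- l = 2.  Complete emptiness therefore forces l = 2 with α and β odd, and an explicit unimodular
-- change of coordinates carries such a pyramid onto U₂.
module Submission where

open import Defs
open import Data.Product using (_×_; Σ; _,_; proj₁; proj₂)

open import Data.Nat as ℕ using (ℕ; zero; suc; z≤n; s≤s; NonZero; >-nonZero)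
  renaming (_+_ to _+ℕ_; _*_ to _*ℕ_; _≤_ to _≤ℕ_; _<_ to _<ℕ_)
import Data.Nat.Properties as ℕ
import Data.Nat.Tactic.RingSolver as ℕ-Solver
open import Algebra.Properties.CommutativeSemigroup ℕ.+-commutativeSemigroup using (x∙yz≈y∙xz)
open import Data.Integer using (ℤ; +_; -_; _+_; _-_; _*_; ∣_∣; 0ℤ; 1ℤ; -1ℤ; -[1+_])
import Data.Integer.Properties as ℤ
open import Data.Integer.DivMod using (_%ℕ_; _/ℕ_; a≡a%ℕn+[a/ℕn]*n; n%ℕd<d)
open import Data.Integer.Tactic.RingSolver using (ring; solve-∀)
open import Tactic.RingSolver.NonReflective ring
  using (Expr; Κ; module Ops) renaming (_⊕_ to _+ᴱ_; _⊗_ to _*ᴱ_; ⊝_ to -ᴱ_; solve to solveℤ)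
open import Data.Sum using (_⊎_; inj₁; inj₂; [_,_]′)
open import Data.Empty using (⊥-elim)
open import Data.List using (List; []; _∷_; map)
open import Data.List.Properties using (map-∘; map-cong; map-id)
open import Data.List.Relation.Unary.Any using (here; there)
open import Data.List.Membership.Propositional using (_∈_)
open import Data.List.Relation.Binary.Permutation.Propositional
  using (_↭_; refl; prep; swap; trans; ↭-sym)
open import Data.List.Relation.Binary.Permutation.Propositional.Properties using (↭-map-inv; map⁺; ∈-resp-↭)
open import Data.Vec using (Vec)
open import Data.Vec.N-ary using (N-ary; curryⁿ; Eq; Eqʰ; curryⁿ-cong; curryⁿ-cong⁻¹; Eqʰ-to-Eq)
open import Relation.Binary.PropositionalEquality
  using (_≡_; _≢_; refl; sym; cong; cong₂; subst; module ≡-Reasoning)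
  renaming (trans to ≡-trans)
open import Relation.Nullary using (¬_; yes; no)

cong-pt : ∀ {a b c a′ b′ c′} → a ≡ a′ → b ≡ b′ → c ≡ c′ → pt a b c ≡ pt a′ b′ c′
cong-pt refl refl refl = refl

-- Mirrors of the operations of Defs on ring expressions: ⟦ e ⟧ₚ ρ reduces to the corresponding
-- point expression, so solvePt proves identities between points coordinatewise.
record Ptᴱ (k : ℕ) : Set where
  constructor ptᴱ
  field
    xᴱ yᴱ zᴱ : Expr ℤ k

record Matᴱ (k : ℕ) : Set where
  constructor matᴱ
  field
    r1ᴱ r2ᴱ r3ᴱ : Ptᴱ k

infixl 6 _⊕ᴱ_ _⊖ᴱ_
infixl 7 _·ᴱ_

_⊕ᴱ_ _⊖ᴱ_ : ∀ {k} → Ptᴱ k → Ptᴱ k → Ptᴱ k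
ptᴱ a b c ⊕ᴱ ptᴱ d e f = ptᴱ (a +ᴱ d) (b +ᴱ e) (c +ᴱ f)
ptᴱ a b c ⊖ᴱ ptᴱ d e f = ptᴱ (a +ᴱ -ᴱ d) (b +ᴱ -ᴱ e) (c +ᴱ -ᴱ f)

_·ᴱ_ : ∀ {k} → Expr ℤ k → Ptᴱ k → Ptᴱ k
s ·ᴱ ptᴱ a b c = ptᴱ (s *ᴱ a) (s *ᴱ b) (s *ᴱ c)

dotᴱ : ∀ {k} → Ptᴱ k → Ptᴱ k → Expr ℤ k
dotᴱ (ptᴱ a b c) (ptᴱ d e f) = a *ᴱ d +ᴱ b *ᴱ e +ᴱ c *ᴱ f

crossᴱ : ∀ {k} → Ptᴱ k → Ptᴱ k → Ptᴱ k
crossᴱ (ptᴱ a b c) (ptᴱ d e f) =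
  ptᴱ (b *ᴱ f +ᴱ -ᴱ (c *ᴱ e)) (c *ᴱ d +ᴱ -ᴱ (a *ᴱ f)) (a *ᴱ e +ᴱ -ᴱ (b *ᴱ d))

det3ᴱ : ∀ {k} → Ptᴱ k → Ptᴱ k → Ptᴱ k → Expr ℤ k
det3ᴱ a b c = dotᴱ a (crossᴱ b c)

appᴱ : ∀ {k} → Matᴱ k → Ptᴱ k → Ptᴱ k
appᴱ (matᴱ r₁ r₂ r₃) x = ptᴱ (dotᴱ r₁ x) (dotᴱ r₂ x) (dotᴱ r₃ x)

colsᴱ : ∀ {k} → Ptᴱ k → Ptᴱ k → Ptᴱ k → Matᴱ k
colsᴱ (ptᴱ a b c) (ptᴱ d e f) (ptᴱ g h i) = matᴱ (ptᴱ a d g) (ptᴱ b e h) (ptᴱ c f i)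

originᴱ : ∀ {k} → Ptᴱ k
originᴱ = ptᴱ (Κ 0ℤ) (Κ 0ℤ) (Κ 0ℤ)

⟦_⟧ₚ ⟦_⇓⟧ₚ : ∀ {k} → Ptᴱ k → Vec ℤ k → Pt
⟦ ptᴱ a b c ⟧ₚ ρ = pt (Ops.⟦ a ⟧ ρ) (Ops.⟦ b ⟧ ρ) (Ops.⟦ c ⟧ ρ)
⟦ ptᴱ a b c ⇓⟧ₚ ρ = pt (Ops.⟦ a ⇓⟧ ρ) (Ops.⟦ b ⇓⟧ ρ) (Ops.⟦ c ⇓⟧ ρ)

correctₚ : ∀ {k} (e : Ptᴱ k) ρ → ⟦ e ⇓⟧ₚ ρ ≡ ⟦ e ⟧ₚ ρ
correctₚ (ptᴱ a b c) ρ = cong-pt (Ops.correct a ρ) (Ops.correct b ρ) (Ops.correct c ρ)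

solvePt : ∀ k (f : N-ary k (Expr ℤ k) (Ptᴱ k × Ptᴱ k)) →
  Eqʰ k _≡_ (curryⁿ ⟦ proj₁ (Ops.close k f) ⇓⟧ₚ) (curryⁿ ⟦ proj₂ (Ops.close k f) ⇓⟧ₚ) →
  Eq k _≡_ (curryⁿ ⟦ proj₁ (Ops.close k f) ⟧ₚ) (curryⁿ ⟦ proj₂ (Ops.close k f) ⟧ₚ)
solvePt k f hyp = curryⁿ-cong _≡_ ⟦ l ⟧ₚ ⟦ r ⟧ₚ λ ρ →
  ≡-trans (sym (correctₚ l ρ))
    (≡-trans (curryⁿ-cong⁻¹ _≡_ ⟦ l ⇓⟧ₚ ⟦ r ⇓⟧ₚ (Eqʰ-to-Eq k _≡_ hyp) ρ) (correctₚ r ρ))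
  where
  l r : Ptᴱ k
  l = proj₁ (Ops.close k f)
  r = proj₂ (Ops.close k f)

cols : Pt → Pt → Pt → Mat
cols f₁ f₂ f₃ = mat (pt (px f₁) (px f₂) (px f₃)) (pt (py f₁) (py f₂) (py f₃)) (pt (pz f₁) (pz f₂) (pz f₃))

affine : Mat → Pt → Pt → Pt
affine M t x = app M x ⊕ t

lift : Pt2 → Pt
lift (pt2 s t) = pt s t 0ℤ

dot-·ˡ : ∀ (k : ℤ) (a b : Pt) → dot (k · a) b ≡ k * dot a b
dot-·ˡ k (pt a₁ a₂ a₃) (pt b₁ b₂ b₃) =
  solveℤ 7 (λ k a₁ a₂ a₃ b₁ b₂ b₃ →
    (dotᴱ (k ·ᴱ ptᴱ a₁ a₂ a₃) (ptᴱ b₁ b₂ b₃) , k *ᴱ dotᴱ (ptᴱ a₁ a₂ a₃) (ptᴱ b₁ b₂ b₃)))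
    refl k a₁ a₂ a₃ b₁ b₂ b₃

dot-·ʳ : ∀ (k : ℤ) (a b : Pt) → dot a (k · b) ≡ k * dot a b
dot-·ʳ k (pt a₁ a₂ a₃) (pt b₁ b₂ b₃) =
  solveℤ 7 (λ k a₁ a₂ a₃ b₁ b₂ b₃ →
    (dotᴱ (ptᴱ a₁ a₂ a₃) (k ·ᴱ ptᴱ b₁ b₂ b₃) , k *ᴱ dotᴱ (ptᴱ a₁ a₂ a₃) (ptᴱ b₁ b₂ b₃)))
    refl k a₁ a₂ a₃ b₁ b₂ b₃

dot-originʳ : ∀ (a : Pt) → dot a origin ≡ 0ℤ
dot-originʳ (pt a₁ a₂ a₃) =
  solveℤ 3 (λ a₁ a₂ a₃ → (dotᴱ (ptᴱ a₁ a₂ a₃) originᴱ , Κ 0ℤ)) refl a₁ a₂ a₃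

dot-⊖-self : ∀ (n a : Pt) → dot n (a ⊖ a) ≡ 0ℤ
dot-⊖-self (pt n₁ n₂ n₃) (pt a₁ a₂ a₃) =
  solveℤ 6 (λ n₁ n₂ n₃ a₁ a₂ a₃ → (dotᴱ (ptᴱ n₁ n₂ n₃) (ptᴱ a₁ a₂ a₃ ⊖ᴱ ptᴱ a₁ a₂ a₃) , Κ 0ℤ))
    refl n₁ n₂ n₃ a₁ a₂ a₃

det3-translate : ∀ (O A B C : Pt) →
  det3 (A ⊖ O) (B ⊖ O) (C ⊖ O) ≡ dot (A ⊖ O) (cross (B ⊖ A) (C ⊖ A))
det3-translate (pt o₁ o₂ o₃) (pt a₁ a₂ a₃) (pt b₁ b₂ b₃) (pt c₁ c₂ c₃) =
  solveℤ 12 (λ o₁ o₂ o₃ a₁ a₂ a₃ b₁ b₂ b₃ c₁ c₂ c₃ →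
    let O = ptᴱ o₁ o₂ o₃; A = ptᴱ a₁ a₂ a₃; B = ptᴱ b₁ b₂ b₃; C = ptᴱ c₁ c₂ c₃ in
    (det3ᴱ (A ⊖ᴱ O) (B ⊖ᴱ O) (C ⊖ᴱ O) , dotᴱ (A ⊖ᴱ O) (crossᴱ (B ⊖ᴱ A) (C ⊖ᴱ A))))
    refl o₁ o₂ o₃ a₁ a₂ a₃ b₁ b₂ b₃ c₁ c₂ c₃

triple-product-expansion : ∀ (n b c y : Pt) →
  dot y (cross b c) · n ≡ dot n y · cross b c ⊖ (dot n c · cross b y ⊖ dot n b · cross c y)
triple-product-expansion (pt n₁ n₂ n₃) (pt b₁ b₂ b₃) (pt c₁ c₂ c₃) (pt y₁ y₂ y₃) =
  solvePt 12 (λ n₁ n₂ n₃ b₁ b₂ b₃ c₁ c₂ c₃ y₁ y₂ y₃ →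
    let n = ptᴱ n₁ n₂ n₃; b = ptᴱ b₁ b₂ b₃; c = ptᴱ c₁ c₂ c₃; y = ptᴱ y₁ y₂ y₃ in
    (dotᴱ y (crossᴱ b c) ·ᴱ n ,
     dotᴱ n y ·ᴱ crossᴱ b c ⊖ᴱ (dotᴱ n c ·ᴱ crossᴱ b y ⊖ᴱ dotᴱ n b ·ᴱ crossᴱ c y)))
    refl n₁ n₂ n₃ b₁ b₂ b₃ c₁ c₂ c₃ y₁ y₂ y₃

cramer-cross : ∀ (b c y : Pt) → let d = cross b c in
  dot d d · y ≡ det3 y c d · b ⊕ det3 b y d · c ⊕ dot y d · d
cramer-cross (pt b₁ b₂ b₃) (pt c₁ c₂ c₃) (pt y₁ y₂ y₃) =
  solvePt 9 (λ b₁ b₂ b₃ c₁ c₂ c₃ y₁ y₂ y₃ →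
    let b = ptᴱ b₁ b₂ b₃; c = ptᴱ c₁ c₂ c₃; y = ptᴱ y₁ y₂ y₃; d = crossᴱ b c in
    (dotᴱ d d ·ᴱ y , det3ᴱ y c d ·ᴱ b ⊕ᴱ det3ᴱ b y d ·ᴱ c ⊕ᴱ dotᴱ y d ·ᴱ d))
    refl b₁ b₂ b₃ c₁ c₂ c₃ y₁ y₂ y₃

zero-combination : ∀ (a b c : Pt) → 0ℤ · a ⊖ (0ℤ · b ⊖ 0ℤ · c) ≡ origin
zero-combination (pt a₁ a₂ a₃) (pt b₁ b₂ b₃) (pt c₁ c₂ c₃) =
  solvePt 9 (λ a₁ a₂ a₃ b₁ b₂ b₃ c₁ c₂ c₃ →
    (Κ 0ℤ ·ᴱ ptᴱ a₁ a₂ a₃ ⊖ᴱ (Κ 0ℤ ·ᴱ ptᴱ b₁ b₂ b₃ ⊖ᴱ Κ 0ℤ ·ᴱ ptᴱ c₁ c₂ c₃) , originᴱ))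
    refl a₁ a₂ a₃ b₁ b₂ b₃ c₁ c₂ c₃

⊕-zero-multiple : ∀ (x d : Pt) → x ⊕ 0ℤ · d ≡ x
⊕-zero-multiple (pt x₁ x₂ x₃) (pt d₁ d₂ d₃) =
  solvePt 6 (λ x₁ x₂ x₃ d₁ d₂ d₃ → (ptᴱ x₁ x₂ x₃ ⊕ᴱ Κ 0ℤ ·ᴱ ptᴱ d₁ d₂ d₃ , ptᴱ x₁ x₂ x₃))
    refl x₁ x₂ x₃ d₁ d₂ d₃

scale-offset : ∀ (k : ℤ) (n P A : Pt) → dot n (P ⊖ A) * k ≡ dot n (k · P) - k * dot n A
scale-offset k (pt n₁ n₂ n₃) (pt p₁ p₂ p₃) (pt a₁ a₂ a₃) =
  solveℤ 10 (λ k n₁ n₂ n₃ p₁ p₂ p₃ a₁ a₂ a₃ →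
    let n = ptᴱ n₁ n₂ n₃; P = ptᴱ p₁ p₂ p₃; A = ptᴱ a₁ a₂ a₃ in
    (dotᴱ n (P ⊖ᴱ A) *ᴱ k , dotᴱ n (k ·ᴱ P) +ᴱ -ᴱ (k *ᴱ dotᴱ n A)))
    refl k n₁ n₂ n₃ p₁ p₂ p₃ a₁ a₂ a₃

combination-offset : ∀ (k₁ k₂ k₃ : ℤ) (n A B C : Pt) →
  dot n (k₁ · A ⊕ k₂ · B ⊕ k₃ · C) - (k₁ + k₂ + k₃) * dot n A ≡ k₂ * dot n (B ⊖ A) + k₃ * dot n (C ⊖ A)
combination-offset k₁ k₂ k₃ (pt n₁ n₂ n₃) (pt a₁ a₂ a₃) (pt b₁ b₂ b₃) (pt c₁ c₂ c₃) =
  solveℤ 15 (λ k₁ k₂ k₃ n₁ n₂ n₃ a₁ a₂ a₃ b₁ b₂ b₃ c₁ c₂ c₃ →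
    let n = ptᴱ n₁ n₂ n₃; A = ptᴱ a₁ a₂ a₃; B = ptᴱ b₁ b₂ b₃; C = ptᴱ c₁ c₂ c₃ in
    (dotᴱ n (k₁ ·ᴱ A ⊕ᴱ k₂ ·ᴱ B ⊕ᴱ k₃ ·ᴱ C) +ᴱ -ᴱ ((k₁ +ᴱ k₂ +ᴱ k₃) *ᴱ dotᴱ n A) ,
     k₂ *ᴱ dotᴱ n (B ⊖ᴱ A) +ᴱ k₃ *ᴱ dotᴱ n (C ⊖ᴱ A)))
    refl k₁ k₂ k₃ n₁ n₂ n₃ a₁ a₂ a₃ b₁ b₂ b₃ c₁ c₂ c₃

⊕-left-comm : ∀ (x y z : Pt) → x ⊕ (y ⊕ z) ≡ y ⊕ (x ⊕ z)
⊕-left-comm (pt x₁ x₂ x₃) (pt y₁ y₂ y₃) (pt z₁ z₂ z₃) =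
  solvePt 9 (λ x₁ x₂ x₃ y₁ y₂ y₃ z₁ z₂ z₃ →
    let x = ptᴱ x₁ x₂ x₃; y = ptᴱ y₁ y₂ y₃; z = ptᴱ z₁ z₂ z₃ in
    (x ⊕ᴱ (y ⊕ᴱ z) , y ⊕ᴱ (x ⊕ᴱ z)))
    refl x₁ x₂ x₃ y₁ y₂ y₃ z₁ z₂ z₃

⊕-assoc₄ : ∀ (w x y z : Pt) → w ⊕ x ⊕ y ⊕ z ≡ w ⊕ (x ⊕ (y ⊕ (z ⊕ origin)))
⊕-assoc₄ (pt w₁ w₂ w₃) (pt x₁ x₂ x₃) (pt y₁ y₂ y₃) (pt z₁ z₂ z₃) =
  solvePt 12 (λ w₁ w₂ w₃ x₁ x₂ x₃ y₁ y₂ y₃ z₁ z₂ z₃ →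
    let w = ptᴱ w₁ w₂ w₃; x = ptᴱ x₁ x₂ x₃; y = ptᴱ y₁ y₂ y₃; z = ptᴱ z₁ z₂ z₃ in
    (w ⊕ᴱ x ⊕ᴱ y ⊕ᴱ z , w ⊕ᴱ (x ⊕ᴱ (y ⊕ᴱ (z ⊕ᴱ originᴱ)))))
    refl w₁ w₂ w₃ x₁ x₂ x₃ y₁ y₂ y₃ z₁ z₂ z₃

affine-scale : ∀ (k : ℤ) (M : Mat) (t x : Pt) → k · affine M t x ≡ app M (k · x) ⊕ k · t
affine-scale k (mat (pt m₁ m₂ m₃) (pt m₄ m₅ m₆) (pt m₇ m₈ m₉)) (pt t₁ t₂ t₃) (pt x₁ x₂ x₃) =
  solvePt 16 (λ k m₁ m₂ m₃ m₄ m₅ m₆ m₇ m₈ m₉ t₁ t₂ t₃ x₁ x₂ x₃ →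
    let M = matᴱ (ptᴱ m₁ m₂ m₃) (ptᴱ m₄ m₅ m₆) (ptᴱ m₇ m₈ m₉); t = ptᴱ t₁ t₂ t₃; x = ptᴱ x₁ x₂ x₃ in
    (k ·ᴱ (appᴱ M x ⊕ᴱ t) , appᴱ M (k ·ᴱ x) ⊕ᴱ k ·ᴱ t))
    refl k m₁ m₂ m₃ m₄ m₅ m₆ m₇ m₈ m₉ t₁ t₂ t₃ x₁ x₂ x₃

affine-combination : ∀ (k₀ k₁ k₂ k₃ : ℤ) (M : Mat) (t O A B C : Pt) →
  app M (k₀ · O ⊕ k₁ · A ⊕ k₂ · B ⊕ k₃ · C) ⊕ (k₀ + k₁ + k₂ + k₃) · t ≡
  k₀ · affine M t O ⊕ k₁ · affine M t A ⊕ k₂ · affine M t B ⊕ k₃ · affine M t C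
affine-combination k₀ k₁ k₂ k₃ (mat (pt m₁ m₂ m₃) (pt m₄ m₅ m₆) (pt m₇ m₈ m₉)) (pt t₁ t₂ t₃)
                   (pt o₁ o₂ o₃) (pt a₁ a₂ a₃) (pt b₁ b₂ b₃) (pt c₁ c₂ c₃) =
  solvePt 28 (λ k₀ k₁ k₂ k₃ m₁ m₂ m₃ m₄ m₅ m₆ m₇ m₈ m₉ t₁ t₂ t₃ o₁ o₂ o₃ a₁ a₂ a₃ b₁ b₂ b₃ c₁ c₂ c₃ →
    let M = matᴱ (ptᴱ m₁ m₂ m₃) (ptᴱ m₄ m₅ m₆) (ptᴱ m₇ m₈ m₉); t = ptᴱ t₁ t₂ t₃
        O = ptᴱ o₁ o₂ o₃; A = ptᴱ a₁ a₂ a₃; B = ptᴱ b₁ b₂ b₃; C = ptᴱ c₁ c₂ c₃ in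
    (appᴱ M (k₀ ·ᴱ O ⊕ᴱ k₁ ·ᴱ A ⊕ᴱ k₂ ·ᴱ B ⊕ᴱ k₃ ·ᴱ C) ⊕ᴱ (k₀ +ᴱ k₁ +ᴱ k₂ +ᴱ k₃) ·ᴱ t ,
     k₀ ·ᴱ (appᴱ M O ⊕ᴱ t) ⊕ᴱ k₁ ·ᴱ (appᴱ M A ⊕ᴱ t) ⊕ᴱ k₂ ·ᴱ (appᴱ M B ⊕ᴱ t) ⊕ᴱ k₃ ·ᴱ (appᴱ M C ⊕ᴱ t)))
    refl k₀ k₁ k₂ k₃ m₁ m₂ m₃ m₄ m₅ m₆ m₇ m₈ m₉ t₁ t₂ t₃ o₁ o₂ o₃ a₁ a₂ a₃ b₁ b₂ b₃ c₁ c₂ c₃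

⊖-self : ∀ (x : Pt) → x ⊖ x ≡ origin
⊖-self (pt x₁ x₂ x₃) = solvePt 3 (λ x₁ x₂ x₃ → (ptᴱ x₁ x₂ x₃ ⊖ᴱ ptᴱ x₁ x₂ x₃ , originᴱ)) refl x₁ x₂ x₃

⊕-⊖-cancel : ∀ (x y : Pt) → x ⊕ y ⊕ (origin ⊖ y) ≡ x
⊕-⊖-cancel (pt x₁ x₂ x₃) (pt y₁ y₂ y₃) =
  solvePt 6 (λ x₁ x₂ x₃ y₁ y₂ y₃ →
    (ptᴱ x₁ x₂ x₃ ⊕ᴱ ptᴱ y₁ y₂ y₃ ⊕ᴱ (originᴱ ⊖ᴱ ptᴱ y₁ y₂ y₃) , ptᴱ x₁ x₂ x₃))
    refl x₁ x₂ x₃ y₁ y₂ y₃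

⊕⊖-cancel : ∀ (x t : Pt) → x ⊕ t ⊖ t ≡ x
⊕⊖-cancel (pt x₁ x₂ x₃) (pt t₁ t₂ t₃) =
  solvePt 6 (λ x₁ x₂ x₃ t₁ t₂ t₃ → (ptᴱ x₁ x₂ x₃ ⊕ᴱ ptᴱ t₁ t₂ t₃ ⊖ᴱ ptᴱ t₁ t₂ t₃ , ptᴱ x₁ x₂ x₃))
    refl x₁ x₂ x₃ t₁ t₂ t₃

⊖⊕-cancel : ∀ (z x : Pt) → z ⊖ x ⊕ x ≡ z
⊖⊕-cancel (pt z₁ z₂ z₃) (pt x₁ x₂ x₃) =
  solvePt 6 (λ z₁ z₂ z₃ x₁ x₂ x₃ → (ptᴱ z₁ z₂ z₃ ⊖ᴱ ptᴱ x₁ x₂ x₃ ⊕ᴱ ptᴱ x₁ x₂ x₃ , ptᴱ z₁ z₂ z₃))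
    refl z₁ z₂ z₃ x₁ x₂ x₃

basis-expansion : ∀ (x : Pt) → px x · pt 1ℤ 0ℤ 0ℤ ⊕ py x · pt 0ℤ 1ℤ 0ℤ ⊕ pz x · pt 0ℤ 0ℤ 1ℤ ≡ x
basis-expansion (pt x₁ x₂ x₃) =
  solvePt 3 (λ x₁ x₂ x₃ →
    (x₁ ·ᴱ ptᴱ (Κ 1ℤ) (Κ 0ℤ) (Κ 0ℤ) ⊕ᴱ x₂ ·ᴱ ptᴱ (Κ 0ℤ) (Κ 1ℤ) (Κ 0ℤ) ⊕ᴱ x₃ ·ᴱ ptᴱ (Κ 0ℤ) (Κ 0ℤ) (Κ 1ℤ) ,
     ptᴱ x₁ x₂ x₃))
    refl x₁ x₂ x₃

dot-combination : ∀ (n f₁ f₂ f₃ : Pt) (a b c : ℤ) →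
  dot n (a · f₁ ⊕ b · f₂ ⊕ c · f₃) ≡ a * dot n f₁ + b * dot n f₂ + c * dot n f₃
dot-combination (pt n₁ n₂ n₃) (pt f₁ f₂ f₃) (pt g₁ g₂ g₃) (pt h₁ h₂ h₃) a b c =
  solveℤ 15 (λ n₁ n₂ n₃ f₁ f₂ f₃ g₁ g₂ g₃ h₁ h₂ h₃ a b c →
    let n = ptᴱ n₁ n₂ n₃; f = ptᴱ f₁ f₂ f₃; g = ptᴱ g₁ g₂ g₃; h = ptᴱ h₁ h₂ h₃ in
    (dotᴱ n (a ·ᴱ f ⊕ᴱ b ·ᴱ g ⊕ᴱ c ·ᴱ h) , a *ᴱ dotᴱ n f +ᴱ b *ᴱ dotᴱ n g +ᴱ c *ᴱ dotᴱ n h))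
    refl n₁ n₂ n₃ f₁ f₂ f₃ g₁ g₂ g₃ h₁ h₂ h₃ a b c

cross-combinationˡ : ∀ (f g h : Pt) (b c : ℤ) → cross (0ℤ · f ⊕ b · g ⊕ c · h) h ≡ b · cross g h
cross-combinationˡ (pt f₁ f₂ f₃) (pt g₁ g₂ g₃) (pt h₁ h₂ h₃) b c =
  solvePt 11 (λ f₁ f₂ f₃ g₁ g₂ g₃ h₁ h₂ h₃ b c →
    let f = ptᴱ f₁ f₂ f₃; g = ptᴱ g₁ g₂ g₃; h = ptᴱ h₁ h₂ h₃ in
    (crossᴱ (Κ 0ℤ ·ᴱ f ⊕ᴱ b ·ᴱ g ⊕ᴱ c ·ᴱ h) h , b ·ᴱ crossᴱ g h))
    refl f₁ f₂ f₃ g₁ g₂ g₃ h₁ h₂ h₃ b c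

cross-combinationʳ : ∀ (f g h : Pt) (b c : ℤ) → cross g (0ℤ · f ⊕ b · g ⊕ c · h) ≡ c · cross g h
cross-combinationʳ (pt f₁ f₂ f₃) (pt g₁ g₂ g₃) (pt h₁ h₂ h₃) b c =
  solvePt 11 (λ f₁ f₂ f₃ g₁ g₂ g₃ h₁ h₂ h₃ b c →
    let f = ptᴱ f₁ f₂ f₃; g = ptᴱ g₁ g₂ g₃; h = ptᴱ h₁ h₂ h₃ in
    (crossᴱ g (Κ 0ℤ ·ᴱ f ⊕ᴱ b ·ᴱ g ⊕ᴱ c ·ᴱ h) , c ·ᴱ crossᴱ g h))
    refl f₁ f₂ f₃ g₁ g₂ g₃ h₁ h₂ h₃ b c

cross-originˡ : ∀ (x : Pt) → cross origin x ≡ origin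
cross-originˡ (pt x₁ x₂ x₃) = solvePt 3 (λ x₁ x₂ x₃ → (crossᴱ originᴱ (ptᴱ x₁ x₂ x₃) , originᴱ)) refl x₁ x₂ x₃

cross-originʳ : ∀ (x : Pt) → cross x origin ≡ origin
cross-originʳ (pt x₁ x₂ x₃) = solvePt 3 (λ x₁ x₂ x₃ → (crossᴱ (ptᴱ x₁ x₂ x₃) originᴱ , originᴱ)) refl x₁ x₂ x₃

cross-antisym : ∀ (x y : Pt) → cross y x ≡ -1ℤ · cross x y
cross-antisym (pt x₁ x₂ x₃) (pt y₁ y₂ y₃) =
  solvePt 6 (λ x₁ x₂ x₃ y₁ y₂ y₃ →
    (crossᴱ (ptᴱ y₁ y₂ y₃) (ptᴱ x₁ x₂ x₃) , Κ -1ℤ ·ᴱ crossᴱ (ptᴱ x₁ x₂ x₃) (ptᴱ y₁ y₂ y₃)))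
    refl x₁ x₂ x₃ y₁ y₂ y₃

app-cols : ∀ (f g h y : Pt) → app (cols f g h) y ≡ px y · f ⊕ py y · g ⊕ pz y · h
app-cols (pt f₁ f₂ f₃) (pt g₁ g₂ g₃) (pt h₁ h₂ h₃) (pt y₁ y₂ y₃) =
  solvePt 12 (λ f₁ f₂ f₃ g₁ g₂ g₃ h₁ h₂ h₃ y₁ y₂ y₃ →
    let f = ptᴱ f₁ f₂ f₃; g = ptᴱ g₁ g₂ g₃; h = ptᴱ h₁ h₂ h₃ in
    (appᴱ (colsᴱ f g h) (ptᴱ y₁ y₂ y₃) , y₁ ·ᴱ f ⊕ᴱ y₂ ·ᴱ g ⊕ᴱ y₃ ·ᴱ h))
    refl f₁ f₂ f₃ g₁ g₂ g₃ h₁ h₂ h₃ y₁ y₂ y₃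

app-combination : ∀ (M : Mat) (a b c : ℤ) (x y z : Pt) →
  app M (a · x ⊕ b · y ⊕ c · z) ≡ a · app M x ⊕ b · app M y ⊕ c · app M z
app-combination (mat (pt m₁ m₂ m₃) (pt m₄ m₅ m₆) (pt m₇ m₈ m₉)) a b c (pt x₁ x₂ x₃) (pt y₁ y₂ y₃) (pt z₁ z₂ z₃) =
  solvePt 21 (λ m₁ m₂ m₃ m₄ m₅ m₆ m₇ m₈ m₉ a b c x₁ x₂ x₃ y₁ y₂ y₃ z₁ z₂ z₃ →
    let M = matᴱ (ptᴱ m₁ m₂ m₃) (ptᴱ m₄ m₅ m₆) (ptᴱ m₇ m₈ m₉)
        x = ptᴱ x₁ x₂ x₃; y = ptᴱ y₁ y₂ y₃; z = ptᴱ z₁ z₂ z₃ in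
    (appᴱ M (a ·ᴱ x ⊕ᴱ b ·ᴱ y ⊕ᴱ c ·ᴱ z) , a ·ᴱ appᴱ M x ⊕ᴱ b ·ᴱ appᴱ M y ⊕ᴱ c ·ᴱ appᴱ M z))
    refl m₁ m₂ m₃ m₄ m₅ m₆ m₇ m₈ m₉ a b c x₁ x₂ x₃ y₁ y₂ y₃ z₁ z₂ z₃

app-⊕ : ∀ (M : Mat) (x y : Pt) → app M (x ⊕ y) ≡ app M x ⊕ app M y
app-⊕ (mat (pt m₁ m₂ m₃) (pt m₄ m₅ m₆) (pt m₇ m₈ m₉)) (pt x₁ x₂ x₃) (pt y₁ y₂ y₃) =
  solvePt 15 (λ m₁ m₂ m₃ m₄ m₅ m₆ m₇ m₈ m₉ x₁ x₂ x₃ y₁ y₂ y₃ →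
    let M = matᴱ (ptᴱ m₁ m₂ m₃) (ptᴱ m₄ m₅ m₆) (ptᴱ m₇ m₈ m₉); x = ptᴱ x₁ x₂ x₃; y = ptᴱ y₁ y₂ y₃ in
    (appᴱ M (x ⊕ᴱ y) , appᴱ M x ⊕ᴱ appᴱ M y))
    refl m₁ m₂ m₃ m₄ m₅ m₆ m₇ m₈ m₉ x₁ x₂ x₃ y₁ y₂ y₃

app-⊖ : ∀ (M : Mat) (x y : Pt) → app M (x ⊖ y) ≡ app M x ⊖ app M y
app-⊖ (mat (pt m₁ m₂ m₃) (pt m₄ m₅ m₆) (pt m₇ m₈ m₉)) (pt x₁ x₂ x₃) (pt y₁ y₂ y₃) =
  solvePt 15 (λ m₁ m₂ m₃ m₄ m₅ m₆ m₇ m₈ m₉ x₁ x₂ x₃ y₁ y₂ y₃ →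
    let M = matᴱ (ptᴱ m₁ m₂ m₃) (ptᴱ m₄ m₅ m₆) (ptᴱ m₇ m₈ m₉); x = ptᴱ x₁ x₂ x₃; y = ptᴱ y₁ y₂ y₃ in
    (appᴱ M (x ⊖ᴱ y) , appᴱ M x ⊖ᴱ appᴱ M y))
    refl m₁ m₂ m₃ m₄ m₅ m₆ m₇ m₈ m₉ x₁ x₂ x₃ y₁ y₂ y₃

affine-origin : ∀ (M : Mat) (t : Pt) → affine M t origin ≡ t
affine-origin (mat (pt m₁ m₂ m₃) (pt m₄ m₅ m₆) (pt m₇ m₈ m₉)) (pt t₁ t₂ t₃) =
  solvePt 12 (λ m₁ m₂ m₃ m₄ m₅ m₆ m₇ m₈ m₉ t₁ t₂ t₃ →
    (appᴱ (matᴱ (ptᴱ m₁ m₂ m₃) (ptᴱ m₄ m₅ m₆) (ptᴱ m₇ m₈ m₉)) originᴱ ⊕ᴱ ptᴱ t₁ t₂ t₃ , ptᴱ t₁ t₂ t₃))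
    refl m₁ m₂ m₃ m₄ m₅ m₆ m₇ m₈ m₉ t₁ t₂ t₃

affine-cols : ∀ (p u v w : Pt) (s t k : ℤ) → affine (cols u v w) p (pt s t k) ≡ aff2 p u v (pt2 s t) ⊕ k · w
affine-cols (pt p₁ p₂ p₃) (pt u₁ u₂ u₃) (pt v₁ v₂ v₃) (pt w₁ w₂ w₃) s t k =
  solvePt 15 (λ p₁ p₂ p₃ u₁ u₂ u₃ v₁ v₂ v₃ w₁ w₂ w₃ s t k →
    let p = ptᴱ p₁ p₂ p₃; u = ptᴱ u₁ u₂ u₃; v = ptᴱ v₁ v₂ v₃; w = ptᴱ w₁ w₂ w₃ in
    (appᴱ (colsᴱ u v w) (ptᴱ s t k) ⊕ᴱ p , p ⊕ᴱ s ·ᴱ u ⊕ᴱ t ·ᴱ v ⊕ᴱ k ·ᴱ w))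
    refl p₁ p₂ p₃ u₁ u₂ u₃ v₁ v₂ v₃ w₁ w₂ w₃ s t k

height-aff2 : ∀ (n p u v A : Pt) (s t : ℤ) →
  dot n (aff2 p u v (pt2 s t) ⊖ A) ≡ dot n (p ⊖ A) + s * dot n u + t * dot n v
height-aff2 (pt n₁ n₂ n₃) (pt p₁ p₂ p₃) (pt u₁ u₂ u₃) (pt v₁ v₂ v₃) (pt a₁ a₂ a₃) s t =
  solveℤ 17 (λ n₁ n₂ n₃ p₁ p₂ p₃ u₁ u₂ u₃ v₁ v₂ v₃ a₁ a₂ a₃ s t →
    let n = ptᴱ n₁ n₂ n₃; p = ptᴱ p₁ p₂ p₃; u = ptᴱ u₁ u₂ u₃; v = ptᴱ v₁ v₂ v₃; A = ptᴱ a₁ a₂ a₃ in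
    (dotᴱ n (p ⊕ᴱ s ·ᴱ u ⊕ᴱ t ·ᴱ v ⊖ᴱ A) , dotᴱ n (p ⊖ᴱ A) +ᴱ s *ᴱ dotᴱ n u +ᴱ t *ᴱ dotᴱ n v))
    refl n₁ n₂ n₃ p₁ p₂ p₃ u₁ u₂ u₃ v₁ v₂ v₃ a₁ a₂ a₃ s t

height-shift : ∀ (n z w A : Pt) (k : ℤ) → dot n (z ⊖ k · w ⊖ A) ≡ dot n (z ⊖ A) - k * dot n w
height-shift (pt n₁ n₂ n₃) (pt z₁ z₂ z₃) (pt w₁ w₂ w₃) (pt a₁ a₂ a₃) k =
  solveℤ 13 (λ n₁ n₂ n₃ z₁ z₂ z₃ w₁ w₂ w₃ a₁ a₂ a₃ k →
    let n = ptᴱ n₁ n₂ n₃; z = ptᴱ z₁ z₂ z₃; w = ptᴱ w₁ w₂ w₃; A = ptᴱ a₁ a₂ a₃ in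
    (dotᴱ n (z ⊖ᴱ k ·ᴱ w ⊖ᴱ A) , dotᴱ n (z ⊖ᴱ A) +ᴱ -ᴱ (k *ᴱ dotᴱ n w)))
    refl n₁ n₂ n₃ z₁ z₂ z₃ w₁ w₂ w₃ a₁ a₂ a₃ k

height-combination : ∀ (n z w A : Pt) (k : ℤ) → dot n (z ⊕ k · w ⊖ A) ≡ dot n (z ⊖ A) + k * dot n w
height-combination (pt n₁ n₂ n₃) (pt z₁ z₂ z₃) (pt w₁ w₂ w₃) (pt a₁ a₂ a₃) k =
  solveℤ 13 (λ n₁ n₂ n₃ z₁ z₂ z₃ w₁ w₂ w₃ a₁ a₂ a₃ k →
    let n = ptᴱ n₁ n₂ n₃; z = ptᴱ z₁ z₂ z₃; w = ptᴱ w₁ w₂ w₃; A = ptᴱ a₁ a₂ a₃ in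
    (dotᴱ n (z ⊕ᴱ k ·ᴱ w ⊖ᴱ A) , dotᴱ n (z ⊖ᴱ A) +ᴱ k *ᴱ dotᴱ n w))
    refl n₁ n₂ n₃ z₁ z₂ z₃ w₁ w₂ w₃ a₁ a₂ a₃ k

*≡0⇒≡0 : ∀ {x y : ℤ} → y ≢ 0ℤ → x * y ≡ 0ℤ → x ≡ 0ℤ
*≡0⇒≡0 {x} {y} y≢0 eq with ℤ.i*j≡0⇒i≡0∨j≡0 x {y} eq
... | inj₁ x≡0 = x≡0
... | inj₂ y≡0 = ⊥-elim (y≢0 y≡0)

below-minimum : ∀ {a m : ℕ} → a <ℕ m → (0 <ℕ a → m ≤ℕ a) → a ≡ 0
below-minimum {zero}  _   _       = refl
below-minimum {suc a} a<m minimal = ⊥-elim (ℕ.<⇒≱ a<m (minimal ℕ.z<s))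

sign-of : ∀ (z : ℤ) → Σ ℤ λ σ → ∣ σ ∣ ≡ 1 × σ * z ≡ + ∣ z ∣
sign-of (+ k)    = 1ℤ , refl , ℤ.*-identityˡ (+ k)
sign-of -[1+ k ] = -1ℤ , refl , ℤ.-1*i≡-i -[1+ k ]

pos-sum₃ : ∀ (a b c : ℕ) {d : ℕ} → a +ℕ b +ℕ c ≡ d → + d ≡ + a + + b + + c
pos-sum₃ a b c refl = ≡-trans (ℤ.pos-+ (a +ℕ b) c) (cong (_+ + c) (ℤ.pos-+ a b))

pos-sum₄ : ∀ (a b c e : ℕ) {d : ℕ} → a +ℕ b +ℕ c +ℕ e ≡ d → + d ≡ + a + + b + + c + + e
pos-sum₄ a b c e refl = ≡-trans (ℤ.pos-+ (a +ℕ b +ℕ c) e) (cong (_+ + e) (pos-sum₃ a b c refl))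

⊖≡origin⇒≡ : ∀ {a b : Pt} → a ⊖ b ≡ origin → a ≡ b
⊖≡origin⇒≡ {pt a₁ a₂ a₃} {pt b₁ b₂ b₃} eq =
  cong-pt (ℤ.i-j≡0⇒i≡j a₁ b₁ (cong px eq)) (ℤ.i-j≡0⇒i≡j a₂ b₂ (cong py eq)) (ℤ.i-j≡0⇒i≡j a₃ b₃ (cong pz eq))

·≡origin⇒≡0 : ∀ {k : ℤ} {x : Pt} → x ≢ origin → k · x ≡ origin → k ≡ 0ℤ
·≡origin⇒≡0 {k} {pt x₁ x₂ x₃} x≢0 eq
  with ℤ.i*j≡0⇒i≡0∨j≡0 k (cong px eq) | ℤ.i*j≡0⇒i≡0∨j≡0 k (cong py eq) | ℤ.i*j≡0⇒i≡0∨j≡0 k (cong pz eq)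
... | inj₁ k≡0 | _          | _          = k≡0
... | _          | inj₁ k≡0 | _          = k≡0
... | _          | _          | inj₁ k≡0 = k≡0
... | inj₂ x₁≡0  | inj₂ x₂≡0  | inj₂ x₃≡0  = ⊥-elim (x≢0 (cong-pt x₁≡0 x₂≡0 x₃≡0))

square≡∣∣² : ∀ (a : ℤ) → a * a ≡ + (∣ a ∣ *ℕ ∣ a ∣)
square≡∣∣² (+ k)    = sym (ℤ.pos-* k k)
square≡∣∣² -[1+ k ] = refl

dot-self≡0⇒≡origin : ∀ {c : Pt} → dot c c ≡ 0ℤ → c ≡ origin
dot-self≡0⇒≡origin {pt a b c} eq = cong-pt (≡0 a a²≡0) (≡0 b b²≡0) (≡0 c c²≡0)
  where
  open ≡-Reasoning
  sq : ℤ → ℕ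
  sq i = ∣ i ∣ *ℕ ∣ i ∣
  sum≡0 : sq a +ℕ sq b +ℕ sq c ≡ 0
  sum≡0 = ℤ.+-injective (begin
    + (sq a +ℕ sq b +ℕ sq c)  ≡⟨ ℤ.pos-+ (sq a +ℕ sq b) (sq c) ⟩
    + (sq a +ℕ sq b) + + sq c ≡⟨ cong (_+ + sq c) (ℤ.pos-+ (sq a) (sq b)) ⟩
    + sq a + + sq b + + sq c  ≡⟨ sym (cong₂ _+_ (cong₂ _+_ (square≡∣∣² a) (square≡∣∣² b)) (square≡∣∣² c)) ⟩
    a * a + b * b + c * c     ≡⟨ eq ⟩
    0ℤ                        ∎)
  a²≡0 : sq a ≡ 0
  a²≡0 = ℕ.m+n≡0⇒m≡0 (sq a) (ℕ.m+n≡0⇒m≡0 (sq a +ℕ sq b) sum≡0)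
  b²≡0 : sq b ≡ 0
  b²≡0 = ℕ.m+n≡0⇒n≡0 (sq a) (ℕ.m+n≡0⇒m≡0 (sq a +ℕ sq b) sum≡0)
  c²≡0 : sq c ≡ 0
  c²≡0 = ℕ.m+n≡0⇒n≡0 (sq a +ℕ sq b) sum≡0
  ≡0 : ∀ (i : ℤ) → sq i ≡ 0 → i ≡ 0ℤ
  ≡0 i i²≡0 with ℕ.m*n≡0⇒m≡0∨n≡0 ∣ i ∣ i²≡0
  ... | inj₁ ∣i∣≡0 = ℤ.∣i∣≡0⇒i≡0 ∣i∣≡0
  ... | inj₂ ∣i∣≡0 = ℤ.∣i∣≡0⇒i≡0 ∣i∣≡0

nondegenerate : ∀ {O A B C : Pt} → IsPyramid O A B C → cross (B ⊖ A) (C ⊖ A) ≢ origin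
nondegenerate {O} {A} {B} {C} pyr d≡0 = pyr (begin
  det3 (A ⊖ O) (B ⊖ O) (C ⊖ O)                ≡⟨ det3-translate O A B C ⟩
  dot (A ⊖ O) (cross (B ⊖ A) (C ⊖ A))         ≡⟨ cong (dot (A ⊖ O)) d≡0 ⟩
  dot (A ⊖ O) origin                          ≡⟨ dot-originʳ (A ⊖ O) ⟩
  0ℤ                                          ∎)
  where open ≡-Reasoning

-- An integer point whose offset from A is orthogonal to a normal of the plane ABC lies on it:
-- the offset is orthogonal to d = (B − A) × (C − A) as well, and Cramer's rule in the basis
-- B − A, C − A, d then writes ∣d∣² times it as an integer combination of B − A and C − A.
orthogonal⇒InPlane : ∀ {A B C x : Pt} (n : Pt) → n ≢ origin → cross (B ⊖ A) (C ⊖ A) ≢ origin →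
  dot n (B ⊖ A) ≡ 0ℤ → dot n (C ⊖ A) ≡ 0ℤ → dot n (x ⊖ A) ≡ 0ℤ → InPlane A B C x
orthogonal⇒InPlane {A} {B} {C} {x} n n≢0 d≢0 n⊥b n⊥c n⊥y =
  dot d d , det3 y c d , det3 b y d , (λ dd≡0 → d≢0 (dot-self≡0⇒≡origin dd≡0)) , plane-equation
  where
  open ≡-Reasoning
  b c y d : Pt
  b = B ⊖ A
  c = C ⊖ A
  y = x ⊖ A
  d = cross b c
  y⊥d : dot y d ≡ 0ℤ
  y⊥d = ·≡origin⇒≡0 n≢0 (begin
    dot y d · n                                              ≡⟨ triple-product-expansion n b c y ⟩
    dot n y · d ⊖ (dot n c · cross b y ⊖ dot n b · cross c y)
      ≡⟨ cong₂ (λ s t → s · d ⊖ (t · cross b y ⊖ dot n b · cross c y)) n⊥y n⊥c ⟩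
    0ℤ · d ⊖ (0ℤ · cross b y ⊖ dot n b · cross c y)          ≡⟨ cong (λ s → 0ℤ · d ⊖ (0ℤ · cross b y ⊖ s · cross c y)) n⊥b ⟩
    0ℤ · d ⊖ (0ℤ · cross b y ⊖ 0ℤ · cross c y)               ≡⟨ zero-combination d (cross b y) (cross c y) ⟩
    origin                                                   ∎)
  plane-equation : dot d d · y ≡ det3 y c d · b ⊕ det3 b y d · c
  plane-equation = begin
    dot d d · y                                              ≡⟨ cramer-cross b c y ⟩
    det3 y c d · b ⊕ det3 b y d · c ⊕ dot y d · d            ≡⟨ cong (λ s → det3 y c d · b ⊕ det3 b y d · c ⊕ s · d) y⊥d ⟩
    det3 y c d · b ⊕ det3 b y d · c ⊕ 0ℤ · d                 ≡⟨ ⊕-zero-multiple _ d ⟩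
    det3 y c d · b ⊕ det3 b y d · c                          ∎

InConv3-orthogonal : ∀ {P A B C : Pt} (n : Pt) → dot n (B ⊖ A) ≡ 0ℤ → dot n (C ⊖ A) ≡ 0ℤ →
  InConv3 P A B C → dot n (P ⊖ A) ≡ 0ℤ
InConv3-orthogonal {P} {A} {B} {C} n n⊥b n⊥c (d , a₁ , a₂ , a₃ , 0<d , sum , eq) =
  *≡0⇒≡0 (λ d≡0 → ℕ.<-irrefl (sym (ℤ.+-injective d≡0)) 0<d) (begin
  dot n (P ⊖ A) * + d                                        ≡⟨ scale-offset (+ d) n P A ⟩
  dot n (+ d · P) - + d * dot n A                            ≡⟨ cong₂ (λ X k → dot n X - k * dot n A) eq (pos-sum₃ a₁ a₂ a₃ sum) ⟩
  dot n (+ a₁ · A ⊕ + a₂ · B ⊕ + a₃ · C) - (+ a₁ + + a₂ + + a₃) * dot n A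
    ≡⟨ combination-offset (+ a₁) (+ a₂) (+ a₃) n A B C ⟩
  + a₂ * dot n (B ⊖ A) + + a₃ * dot n (C ⊖ A)               ≡⟨ cong₂ (λ s t → + a₂ * s + + a₃ * t) n⊥b n⊥c ⟩
  + a₂ * 0ℤ + + a₃ * 0ℤ                                      ≡⟨ cong₂ _+_ (ℤ.*-zeroʳ (+ a₂)) (ℤ.*-zeroʳ (+ a₃)) ⟩
  0ℤ                                                         ∎)
  where open ≡-Reasoning

vanishing-on-reference-triangle : ∀ {P U V : ℤ} →
  P + + 2 * U + 0ℤ * V ≡ 0ℤ → P + 0ℤ * U + - 1ℤ * V ≡ 0ℤ → P + 0ℤ * U + 1ℤ * V ≡ 0ℤ →
  P ≡ 0ℤ × U ≡ 0ℤ × V ≡ 0ℤ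
vanishing-on-reference-triangle {P} {U} {V} at-a at-b at-c = P≡0 , U≡0 , V≡0
  where
  2≢0 : + 2 ≢ 0ℤ
  2≢0 ()
  sum-bc : ∀ (P U V : ℤ) → P * + 2 ≡ (P + 0ℤ * U + - 1ℤ * V) + (P + 0ℤ * U + 1ℤ * V)
  sum-bc = solve-∀
  diff-c : ∀ (P U V : ℤ) → V ≡ (P + 0ℤ * U + 1ℤ * V) - P
  diff-c = solve-∀
  diff-a : ∀ (P U V : ℤ) → U * + 2 ≡ (P + + 2 * U + 0ℤ * V) - P
  diff-a = solve-∀
  P≡0 : P ≡ 0ℤ
  P≡0 = *≡0⇒≡0 2≢0 (≡-trans (sum-bc P U V) (cong₂ _+_ at-b at-c))
  V≡0 : V ≡ 0ℤ
  V≡0 = ≡-trans (diff-c P U V) (cong₂ _-_ at-c P≡0)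
  U≡0 : U ≡ 0ℤ
  U≡0 = *≡0⇒≡0 2≢0 (≡-trans (diff-a P U V) (cong₂ _-_ at-a P≡0))

combination : List (ℕ × Pt) → Pt
combination []            = origin
combination ((a , X) ∷ r) = + a · X ⊕ combination r

weight : List (ℕ × Pt) → ℕ
weight []            = 0
weight ((a , _) ∷ r) = a +ℕ weight r

combination-↭ : ∀ {xs ys} → xs ↭ ys → combination xs ≡ combination ys
combination-↭ refl                = refl
combination-↭ (prep (a , X) p)    = cong (+ a · X ⊕_) (combination-↭ p)
combination-↭ {_ ∷ _ ∷ _} {_ ∷ _ ∷ ys} (swap (a , X) (b , Y) p) =
  ≡-trans (cong (λ r → + a · X ⊕ (+ b · Y ⊕ r)) (combination-↭ p)) (⊕-left-comm (+ a · X) (+ b · Y) (combination ys))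
combination-↭ (trans p q)         = ≡-trans (combination-↭ p) (combination-↭ q)

weight-↭ : ∀ {xs ys} → xs ↭ ys → weight xs ≡ weight ys
weight-↭ refl                = refl
weight-↭ (prep (a , X) p)    = cong (a +ℕ_) (weight-↭ p)
weight-↭ {_ ∷ _ ∷ _} {_ ∷ _ ∷ ys} (swap (a , X) (b , Y) p) =
  ≡-trans (cong (λ r → a +ℕ (b +ℕ r)) (weight-↭ p)) (x∙yz≈y∙xz a b (weight ys))
weight-↭ (trans p q)         = ≡-trans (weight-↭ p) (weight-↭ q)

+ℕ-assoc₄ : ∀ (a b c e : ℕ) → a +ℕ b +ℕ c +ℕ e ≡ a +ℕ (b +ℕ (c +ℕ (e +ℕ 0)))
+ℕ-assoc₄ = ℕ-Solver.solve-∀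

combination-base : ∀ {A B C : Pt} {ys : List (ℕ × Pt)} → A ∷ B ∷ C ∷ [] ≡ map proj₂ ys →
  Σ ℕ λ b₁ → Σ ℕ λ b₂ → Σ ℕ λ b₃ → ys ≡ (b₁ , A) ∷ (b₂ , B) ∷ (b₃ , C) ∷ []
combination-base {ys = (b₁ , _) ∷ (b₂ , _) ∷ (b₃ , _) ∷ []} refl = b₁ , b₂ , b₃ , refl

InConv4-resp-↭ : ∀ {P O A B C A′ B′ C′ : Pt} → (A ∷ B ∷ C ∷ []) ↭ (A′ ∷ B′ ∷ C′ ∷ []) →
  InConv4 P O A B C → InConv4 P O A′ B′ C′
InConv4-resp-↭ {P} {O} {A} {B} {C} {A′} {B′} {C′} perm (d , a₀ , a₁ , a₂ , a₃ , 0<d , sum , eq)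
  with ↭-map-inv proj₂ {xs = (a₁ , A) ∷ (a₂ , B) ∷ (a₃ , C) ∷ []} perm
... | ys , ys-points , perm′ with combination-base ys-points
... | b₁ , b₂ , b₃ , refl = d , a₀ , b₁ , b₂ , b₃ , 0<d , sum′ , eq′
  where
  open ≡-Reasoning
  sum′ : a₀ +ℕ b₁ +ℕ b₂ +ℕ b₃ ≡ d
  sum′ = begin
    a₀ +ℕ b₁ +ℕ b₂ +ℕ b₃               ≡⟨ +ℕ-assoc₄ a₀ b₁ b₂ b₃ ⟩
    a₀ +ℕ (b₁ +ℕ (b₂ +ℕ (b₃ +ℕ 0)))    ≡⟨ cong (a₀ +ℕ_) (weight-↭ perm′) ⟨
    a₀ +ℕ (a₁ +ℕ (a₂ +ℕ (a₃ +ℕ 0)))    ≡⟨ +ℕ-assoc₄ a₀ a₁ a₂ a₃ ⟨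
    a₀ +ℕ a₁ +ℕ a₂ +ℕ a₃               ≡⟨ sum ⟩
    d                                  ∎
  eq′ : + d · P ≡ + a₀ · O ⊕ + b₁ · A′ ⊕ + b₂ · B′ ⊕ + b₃ · C′
  eq′ = begin
    + d · P                                               ≡⟨ eq ⟩
    + a₀ · O ⊕ + a₁ · A ⊕ + a₂ · B ⊕ + a₃ · C             ≡⟨ ⊕-assoc₄ (+ a₀ · O) (+ a₁ · A) (+ a₂ · B) (+ a₃ · C) ⟩
    + a₀ · O ⊕ combination ((a₁ , A) ∷ (a₂ , B) ∷ (a₃ , C) ∷ [])      ≡⟨ cong (+ a₀ · O ⊕_) (combination-↭ perm′) ⟩
    + a₀ · O ⊕ combination ((b₁ , A′) ∷ (b₂ , B′) ∷ (b₃ , C′) ∷ [])   ≡⟨ ⊕-assoc₄ (+ a₀ · O) (+ b₁ · A′) (+ b₂ · B′) (+ b₃ · C′) ⟨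
    + a₀ · O ⊕ + b₁ · A′ ⊕ + b₂ · B′ ⊕ + b₃ · C′          ∎

InConv4-affine : ∀ (M : Mat) (t : Pt) {P O A B C O′ A′ B′ C′ : Pt} →
  affine M t O ≡ O′ → affine M t A ≡ A′ → affine M t B ≡ B′ → affine M t C ≡ C′ →
  InConv4 P O A B C → InConv4 (affine M t P) O′ A′ B′ C′
InConv4-affine M t {P} {O} {A} {B} {C} refl refl refl refl (d , a₀ , a₁ , a₂ , a₃ , 0<d , sum , eq) =
  d , a₀ , a₁ , a₂ , a₃ , 0<d , sum , (begin
    + d · affine M t P                                             ≡⟨ affine-scale (+ d) M t P ⟩
    app M (+ d · P) ⊕ + d · t                                      ≡⟨ cong₂ (λ X k → app M X ⊕ k · t) eq (pos-sum₄ a₀ a₁ a₂ a₃ sum) ⟩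
    app M (+ a₀ · O ⊕ + a₁ · A ⊕ + a₂ · B ⊕ + a₃ · C) ⊕ (+ a₀ + + a₁ + + a₂ + + a₃) · t
      ≡⟨ affine-combination (+ a₀) (+ a₁) (+ a₂) (+ a₃) M t O A B C ⟩
    + a₀ · affine M t O ⊕ + a₁ · affine M t A ⊕ + a₂ · affine M t B ⊕ + a₃ · affine M t C ∎)
  where open ≡-Reasoning

cols-injective : ∀ {n f₁ f₂ f₃ : Pt} → dot n f₁ ≢ 0ℤ → dot n f₂ ≡ 0ℤ → dot n f₃ ≡ 0ℤ →
  cross f₂ f₃ ≢ origin → ∀ y → app (cols f₁ f₂ f₃) y ≡ origin → y ≡ origin
cols-injective {n} {f₁} {f₂} {f₃} nf₁≢0 nf₂≡0 nf₃≡0 f₂×f₃≢0 (pt y₁ y₂ y₃) image≡0 = cong-pt y₁≡0 y₂≡0 y₃≡0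
  where
  open ≡-Reasoning
  combination≡0 : y₁ · f₁ ⊕ y₂ · f₂ ⊕ y₃ · f₃ ≡ origin
  combination≡0 = ≡-trans (sym (app-cols f₁ f₂ f₃ (pt y₁ y₂ y₃))) image≡0
  drop-zeros : ∀ (a b c : ℤ) → a + b * 0ℤ + c * 0ℤ ≡ a
  drop-zeros = solve-∀
  y₁≡0 : y₁ ≡ 0ℤ
  y₁≡0 = *≡0⇒≡0 nf₁≢0 (begin
    y₁ * dot n f₁                                          ≡⟨ drop-zeros (y₁ * dot n f₁) y₂ y₃ ⟨
    y₁ * dot n f₁ + y₂ * 0ℤ + y₃ * 0ℤ                      ≡⟨ cong₂ (λ s t → y₁ * dot n f₁ + y₂ * s + y₃ * t) nf₂≡0 nf₃≡0 ⟨
    y₁ * dot n f₁ + y₂ * dot n f₂ + y₃ * dot n f₃          ≡⟨ dot-combination n f₁ f₂ f₃ y₁ y₂ y₃ ⟨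
    dot n (y₁ · f₁ ⊕ y₂ · f₂ ⊕ y₃ · f₃)                    ≡⟨ cong (dot n) combination≡0 ⟩
    dot n origin                                           ≡⟨ dot-originʳ n ⟩
    0ℤ                                                     ∎)
  rest≡0 : 0ℤ · f₁ ⊕ y₂ · f₂ ⊕ y₃ · f₃ ≡ origin
  rest≡0 = subst (λ a → a · f₁ ⊕ y₂ · f₂ ⊕ y₃ · f₃ ≡ origin) y₁≡0 combination≡0
  y₂≡0 : y₂ ≡ 0ℤ
  y₂≡0 = ·≡origin⇒≡0 f₂×f₃≢0 (begin
    y₂ · cross f₂ f₃                                       ≡⟨ cross-combinationˡ f₁ f₂ f₃ y₂ y₃ ⟨
    cross (0ℤ · f₁ ⊕ y₂ · f₂ ⊕ y₃ · f₃) f₃                 ≡⟨ cong (λ x → cross x f₃) rest≡0 ⟩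
    cross origin f₃                                        ≡⟨ cross-originˡ f₃ ⟩
    origin                                                 ∎)
  y₃≡0 : y₃ ≡ 0ℤ
  y₃≡0 = ·≡origin⇒≡0 f₂×f₃≢0 (begin
    y₃ · cross f₂ f₃                                       ≡⟨ cross-combinationʳ f₁ f₂ f₃ y₂ y₃ ⟨
    cross f₂ (0ℤ · f₁ ⊕ y₂ · f₂ ⊕ y₃ · f₃)                 ≡⟨ cong (cross f₂) rest≡0 ⟩
    cross f₂ origin                                        ≡⟨ cross-originʳ f₂ ⟩
    origin                                                 ∎)

bijective⇒inverse : ∀ (N : Mat) → (∀ y → app N y ≡ origin → y ≡ origin) → (∀ z → Σ Pt λ y → app N y ≡ z) →
  Σ Mat λ M → (∀ x → app M (app N x) ≡ x) × (∀ x → app N (app M x) ≡ x)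
bijective⇒inverse N injective onto = M , M∘N , N∘M
  where
  open ≡-Reasoning
  g₁ g₂ g₃ : Pt
  g₁ = proj₁ (onto (pt 1ℤ 0ℤ 0ℤ))
  g₂ = proj₁ (onto (pt 0ℤ 1ℤ 0ℤ))
  g₃ = proj₁ (onto (pt 0ℤ 0ℤ 1ℤ))
  M : Mat
  M = cols g₁ g₂ g₃
  N∘M : ∀ x → app N (app M x) ≡ x
  N∘M x = begin
    app N (app M x)                                       ≡⟨ cong (app N) (app-cols g₁ g₂ g₃ x) ⟩
    app N (px x · g₁ ⊕ py x · g₂ ⊕ pz x · g₃)             ≡⟨ app-combination N (px x) (py x) (pz x) g₁ g₂ g₃ ⟩
    px x · app N g₁ ⊕ py x · app N g₂ ⊕ pz x · app N g₃
      ≡⟨ cong₂ (λ a b → px x · a ⊕ py x · b ⊕ pz x · app N g₃) (proj₂ (onto _)) (proj₂ (onto _)) ⟩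
    px x · pt 1ℤ 0ℤ 0ℤ ⊕ py x · pt 0ℤ 1ℤ 0ℤ ⊕ pz x · app N g₃
      ≡⟨ cong (λ c → px x · pt 1ℤ 0ℤ 0ℤ ⊕ py x · pt 0ℤ 1ℤ 0ℤ ⊕ pz x · c) (proj₂ (onto _)) ⟩
    px x · pt 1ℤ 0ℤ 0ℤ ⊕ py x · pt 0ℤ 1ℤ 0ℤ ⊕ pz x · pt 0ℤ 0ℤ 1ℤ   ≡⟨ basis-expansion x ⟩
    x                                                     ∎
  M∘N : ∀ x → app M (app N x) ≡ x
  M∘N x = ⊖≡origin⇒≡ (injective (app M (app N x) ⊖ x) (begin
    app N (app M (app N x) ⊖ x)                           ≡⟨ app-⊖ N (app M (app N x)) x ⟩
    app N (app M (app N x)) ⊖ app N x                     ≡⟨ cong (_⊖ app N x) (N∘M (app N x)) ⟩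
    app N x ⊖ app N x                                     ≡⟨ ⊖-self (app N x) ⟩
    origin                                                ∎))

PyrEquiv-inverse : ∀ {O A B C O′ A′ B′ C′ : Pt} (N M : Mat) (t : Pt) →
  (∀ x → app M (app N x) ≡ x) → (∀ x → app N (app M x) ≡ x) →
  affine N t O′ ≡ O → map (affine N t) (A′ ∷ B′ ∷ C′ ∷ []) ↭ (A ∷ B ∷ C ∷ []) →
  PyrEquiv O A B C O′ A′ B′ C′
PyrEquiv-inverse {A = A} {B} {C} {O′} {A′} {B′} {C′} N M t M∘N N∘M refl base =
  M , N , s , M∘N , N∘M , undo O′ ,
  subst (map (affine M s) (A ∷ B ∷ C ∷ []) ↭_) undo-all (map⁺ (affine M s) (↭-sym base))
  where
  open ≡-Reasoning
  s : Pt
  s = origin ⊖ app M t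
  undo : ∀ x → affine M s (affine N t x) ≡ x
  undo x = begin
    app M (app N x ⊕ t) ⊕ s               ≡⟨ cong (_⊕ s) (app-⊕ M (app N x) t) ⟩
    app M (app N x) ⊕ app M t ⊕ s         ≡⟨ ⊕-⊖-cancel (app M (app N x)) (app M t) ⟩
    app M (app N x)                       ≡⟨ M∘N x ⟩
    x                                     ∎
  undo-all : map (affine M s) (map (affine N t) (A′ ∷ B′ ∷ C′ ∷ [])) ≡ A′ ∷ B′ ∷ C′ ∷ []
  undo-all = ≡-trans (sym (map-∘ {g = affine M s} {f = affine N t} (A′ ∷ B′ ∷ C′ ∷ [])))
    (≡-trans (map-cong undo (A′ ∷ B′ ∷ C′ ∷ [])) (map-id (A′ ∷ B′ ∷ C′ ∷ [])))

record MidLevelPoint (l : ℕ) (α β : ℤ) : Set where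
  constructor mid-level
  field
    j     : ℕ
    0<j   : 0 <ℕ j
    j<l   : j <ℕ l
    x y   : ℤ
    point : InConv4 (pt x y (+ j)) (pt α β (+ l)) (lift T-a) (lift T-b) (lift T-c)

Odd : ℤ → Set
Odd α = Σ ℤ λ x → α ≡ x * + 2 - 1ℤ

slice-equation : ∀ (L J E F c₂ c₃ x y α β : ℤ) → L * x ≡ J * α + E → L * y ≡ J * β + F → c₃ ≡ c₂ + + 4 * F →
  (+ 4 * L) · pt x y J ≡ (+ 4 * J) · pt α β L ⊕ (+ 2 * E) · lift T-a ⊕ c₂ · lift T-b ⊕ c₃ · lift T-c
slice-equation L J E F c₂ _ x y α β hx hy refl = cong-pt
  (≡-trans (ℤ.*-assoc (+ 4) L x) (≡-trans (cong (+ 4 *_) hx) (first J α E c₂ F)))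
  (≡-trans (ℤ.*-assoc (+ 4) L y) (≡-trans (cong (+ 4 *_) hy) (second J β E c₂ F)))
  (third L J E c₂ F)
  where
  first : ∀ (J α E c₂ F : ℤ) →
    + 4 * (J * α + E) ≡ + 4 * J * α + + 2 * E * + 2 + c₂ * 0ℤ + (c₂ + + 4 * F) * 0ℤ
  first = solve-∀
  second : ∀ (J β E c₂ F : ℤ) →
    + 4 * (J * β + F) ≡ + 4 * J * β + + 2 * E * 0ℤ + c₂ * - 1ℤ + (c₂ + + 4 * F) * 1ℤ
  second = solve-∀
  third : ∀ (L J E c₂ F : ℤ) →
    + 4 * L * J ≡ + 4 * J * L + + 2 * E * 0ℤ + c₂ * 0ℤ + (c₂ + + 4 * F) * 0ℤ
  third = solve-∀

-- The barycentric coordinates of (x, y, j) are those of the offset (l x − j α, l y − j β) in the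
-- triangle (l − j)·T, with denominator 4 l.
mid-level-point : ∀ {l j : ℕ} {α β x y F : ℤ} (e c₂ c₃ : ℕ) → 0 <ℕ j → j <ℕ l →
  + l * x ≡ + j * α + + e → + l * y ≡ + j * β + F → + c₃ ≡ + c₂ + + 4 * F →
  4 *ℕ j +ℕ 2 *ℕ e +ℕ c₂ +ℕ c₃ ≡ 4 *ℕ l → MidLevelPoint l α β
mid-level-point {l} {j} {α} {β} {x} {y} {F} e c₂ c₃ 0<j j<l hx hy hc sum =
  mid-level j 0<j j<l x y (4 *ℕ l , 4 *ℕ j , 2 *ℕ e , c₂ , c₃ , ℕ.*-monoʳ-< 4 (ℕ.m<n⇒0<n j<l) , sum , equation)
  where
  equation : + (4 *ℕ l) · pt x y (+ j) ≡
    + (4 *ℕ j) · pt α β (+ l) ⊕ + (2 *ℕ e) · lift T-a ⊕ + c₂ · lift T-b ⊕ + c₃ · lift T-c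
  equation = ≡-trans (cong (_· pt x y (+ j)) (ℤ.pos-* 4 l))
    (≡-trans (slice-equation (+ l) (+ j) (+ e) F (+ c₂) (+ c₃) x y α β hx hy hc)
      (cong₂ (λ J E → J · pt α β (+ l) ⊕ E · lift T-a ⊕ + c₂ · lift T-b ⊕ + c₃ · lift T-c)
        (sym (ℤ.pos-* 4 j)) (sym (ℤ.pos-* 2 e))))

round-up : ∀ (z : ℤ) (l : ℕ) .{{_ : NonZero l}} → Σ ℕ λ a → Σ ℤ λ x → a <ℕ l × z ≡ x * + l - + a
round-up z l = a , - q , n%ℕd<d (- z) l , (begin
  z                   ≡⟨ ℤ.neg-involutive z ⟨
  - (- z)             ≡⟨ cong -_ (a≡a%ℕn+[a/ℕn]*n (- z) l) ⟩
  - (+ a + q * + l)   ≡⟨ negate (+ a) q (+ l) ⟩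
  - q * + l - + a     ∎)
  where
  open ≡-Reasoning
  a : ℕ
  a = (- z) %ℕ l
  q : ℤ
  q = (- z) /ℕ l
  negate : ∀ (a q l : ℤ) → - (a + q * l) ≡ - q * l - a
  negate = solve-∀

residue-cases : ∀ {l a r : ℕ} → a <ℕ l → r <ℕ l →
  (Σ ℕ λ k → 2 +ℕ a +ℕ (r +ℕ r) +ℕ k ≡ l +ℕ l) ⊎ (Σ ℕ λ k → 2 +ℕ a +ℕ k ≡ r +ℕ r) ⊎ (suc a ≡ l × r +ℕ r ≡ l)
residue-cases {l} {a} {r} a<l r<l with r +ℕ r ℕ.≤? l
... | no r+r≰l = inj₂ (inj₁ (ℕ.m≤n⇒∃[o]m+o≡n (ℕ.≤-<-trans a<l (ℕ.≰⇒> r+r≰l))))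
... | yes r+r≤l with ℕ.m≤n⇒m<n∨m≡n a<l | ℕ.m≤n⇒m<n∨m≡n r+r≤l
...   | inj₁ a+1<l | _          = inj₁ (ℕ.m≤n⇒∃[o]m+o≡n (ℕ.+-mono-≤ a+1<l r+r≤l))
...   | inj₂ _     | inj₁ r+r<l =
  inj₁ (ℕ.m≤n⇒∃[o]m+o≡n (subst (_≤ℕ l +ℕ l) (ℕ.+-suc (suc a) (r +ℕ r)) (ℕ.+-mono-≤ a<l r+r<l)))
...   | inj₂ a+1≡l | inj₂ r+r≡l = inj₂ (inj₂ (a+1≡l , r+r≡l))

ceiling-offset : ∀ (L x a : ℤ) → L * x ≡ 1ℤ * (x * L - a) + a
ceiling-offset = solve-∀

level-one-point-ceil : ∀ {l a r k : ℕ} (x y : ℤ) → 2 ≤ℕ l → 2 +ℕ a +ℕ (r +ℕ r) +ℕ k ≡ l +ℕ l →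
  MidLevelPoint l (x * + l - + a) (y * + l - + r)
level-one-point-ceil {l} {a} {r} {k} x y 2≤l room =
  mid-level-point a k (k +ℕ 4 *ℕ r) ℕ.z<s 2≤l (ceiling-offset (+ l) x (+ a)) (ceiling-offset (+ l) y (+ r))
    (cong (_+_ (+ k)) (ℤ.pos-* 4 r)) (begin
      4 *ℕ 1 +ℕ 2 *ℕ a +ℕ k +ℕ (k +ℕ 4 *ℕ r)   ≡⟨ double a r k ⟩
      2 *ℕ (2 +ℕ a +ℕ (r +ℕ r) +ℕ k)          ≡⟨ cong (2 *ℕ_) room ⟩
      2 *ℕ (l +ℕ l)                            ≡⟨ quadruple l ⟩
      4 *ℕ l                                   ∎)
  where
  open ≡-Reasoning
  double : ∀ (a r k : ℕ) → 4 *ℕ 1 +ℕ 2 *ℕ a +ℕ k +ℕ (k +ℕ 4 *ℕ r) ≡ 2 *ℕ (2 +ℕ a +ℕ (r +ℕ r) +ℕ k)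
  double = ℕ-Solver.solve-∀
  quadruple : ∀ (l : ℕ) → 2 *ℕ (l +ℕ l) ≡ 4 *ℕ l
  quadruple = ℕ-Solver.solve-∀

level-one-point-floor : ∀ {l a r k f : ℕ} (x y : ℤ) → 2 ≤ℕ l → r +ℕ f ≡ l → 2 +ℕ a +ℕ k ≡ r +ℕ r →
  MidLevelPoint l (x * + l - + a) (y * + l - + r)
level-one-point-floor {a = a} {r} {k} {f} x y 2≤l refl room =
  mid-level-point a (k +ℕ 4 *ℕ f) k ℕ.z<s 2≤l (ceiling-offset (+ r + + f) x (+ a)) (floor-offset (+ r) (+ f) y)
    (≡-trans (cancel (+ k) (+ f)) (cong (λ c → + k + c + + 4 * - + f) (sym (ℤ.pos-* 4 f)))) (begin
      4 *ℕ 1 +ℕ 2 *ℕ a +ℕ (k +ℕ 4 *ℕ f) +ℕ k   ≡⟨ double a k f ⟩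
      2 *ℕ (2 +ℕ a +ℕ k) +ℕ 4 *ℕ f            ≡⟨ cong (λ m → 2 *ℕ m +ℕ 4 *ℕ f) room ⟩
      2 *ℕ (r +ℕ r) +ℕ 4 *ℕ f                 ≡⟨ collect r f ⟩
      4 *ℕ (r +ℕ f)                            ∎)
  where
  open ≡-Reasoning
  floor-offset : ∀ (r f y : ℤ) → (r + f) * (y - 1ℤ) ≡ 1ℤ * (y * (r + f) - r) + - f
  floor-offset = solve-∀
  cancel : ∀ (k f : ℤ) → k ≡ k + + 4 * f + + 4 * - f
  cancel = solve-∀
  double : ∀ (a k f : ℕ) → 4 *ℕ 1 +ℕ 2 *ℕ a +ℕ (k +ℕ 4 *ℕ f) +ℕ k ≡ 2 *ℕ (2 +ℕ a +ℕ k) +ℕ 4 *ℕ f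
  double = ℕ-Solver.solve-∀
  collect : ∀ (r f : ℕ) → 2 *ℕ (r +ℕ r) +ℕ 4 *ℕ f ≡ 4 *ℕ (r +ℕ f)
  collect = ℕ-Solver.solve-∀

level-two-point-or-odd : ∀ {l a r : ℕ} (x y : ℤ) → suc a ≡ l → r +ℕ r ≡ l →
  MidLevelPoint l (x * + l - + a) (y * + l - + r) ⊎ (l ≡ 2 × Odd (x * + l - + a) × Odd (y * + l - + r))
level-two-point-or-odd {r = zero}        x y refl ()
level-two-point-or-odd {r = suc zero}    x y refl refl = inj₂ (refl , (x , refl) , (y , refl))
level-two-point-or-odd {r = suc (suc s)} x y refl refl =
  inj₁ (mid-level-point e e e ℕ.z<s (s≤s (s≤s (ℕ.≤-trans (s≤s z≤n) (ℕ.m≤n+m (suc (suc s)) s))))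
    (first (+ e) x) (second (+ s) y) (pad (+ e)) (sum e))
  where
  e : ℕ
  e = s +ℕ suc (suc s)
  first : ∀ (E x : ℤ) → (+ 2 + E) * (x * + 2 - 1ℤ) ≡ + 2 * (x * (+ 2 + E) - (1ℤ + E)) + E
  first = solve-∀
  second : ∀ (S y : ℤ) →
    (+ 2 + (S + (+ 2 + S))) * (y * + 2 - 1ℤ) ≡ + 2 * (y * (+ 2 + (S + (+ 2 + S))) - (+ 2 + S)) + 0ℤ
  second = solve-∀
  pad : ∀ (E : ℤ) → E ≡ E + + 4 * 0ℤ
  pad = solve-∀
  sum : ∀ (e : ℕ) → 4 *ℕ 2 +ℕ 2 *ℕ e +ℕ e +ℕ e ≡ 4 *ℕ (2 +ℕ e)
  sum = ℕ-Solver.solve-∀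

mid-level-point-or-odd : ∀ (l : ℕ) → 2 ≤ℕ l → ∀ (α β : ℤ) → MidLevelPoint l α β ⊎ (l ≡ 2 × Odd α × Odd β)
mid-level-point-or-odd l@(suc _) 2≤l α β with round-up α l | round-up β l
... | a , x , a<l , refl | r , y , r<l , refl with residue-cases a<l r<l
...   | inj₁ (_ , room)              = inj₁ (level-one-point-ceil x y 2≤l room)
...   | inj₂ (inj₁ (_ , room))       = inj₁ (level-one-point-floor x y 2≤l (proj₂ (ℕ.m≤n⇒∃[o]m+o≡n (ℕ.<⇒≤ r<l))) room)
...   | inj₂ (inj₂ (a+1≡l , r+r≡l)) = level-two-point-or-odd x y a+1≡l r+r≡l

-- Columns w′, v, u of the linear part of an affine map carrying U₂ onto the pyramid whose apex
-- has coordinates (2x − 1, 2y − 1, 2) in the frame p; u, v, w.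
U2-frame : Pt → Pt → Pt → ℤ → ℤ → Mat
U2-frame u v w x y = cols ((1ℤ - x) · u ⊕ - y · v ⊕ -1ℤ · w) v u

U2-frame-onto : ∀ (u v w : Pt) (x y s t k : ℤ) →
  app (U2-frame u v w x y) (pt (- k) (t - k * y) (s + k * (1ℤ - x))) ≡ app (cols u v w) (pt s t k)
U2-frame-onto (pt u₁ u₂ u₃) (pt v₁ v₂ v₃) (pt w₁ w₂ w₃) x y s t k =
  solvePt 14 (λ u₁ u₂ u₃ v₁ v₂ v₃ w₁ w₂ w₃ x y s t k →
    let u = ptᴱ u₁ u₂ u₃; v = ptᴱ v₁ v₂ v₃; w = ptᴱ w₁ w₂ w₃ in
    (appᴱ (colsᴱ ((Κ 1ℤ +ᴱ -ᴱ x) ·ᴱ u ⊕ᴱ (-ᴱ y) ·ᴱ v ⊕ᴱ Κ -1ℤ ·ᴱ w) v u)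
          (ptᴱ (-ᴱ k) (t +ᴱ -ᴱ (k *ᴱ y)) (s +ᴱ k *ᴱ (Κ 1ℤ +ᴱ -ᴱ x))) ,
     appᴱ (colsᴱ u v w) (ptᴱ s t k)))
    refl u₁ u₂ u₃ v₁ v₂ v₃ w₁ w₂ w₃ x y s t k

U2-frame-level-two : ∀ (p u v w : Pt) (x y b c : ℤ) →
  affine (U2-frame u v w x y) (affine (cols u v w) p (pt (x * + 2 - 1ℤ) (y * + 2 - 1ℤ) (+ 2))) (pt (+ 2) b c)
    ≡ aff2 p u v (pt2 (1ℤ + c) (b - 1ℤ))
U2-frame-level-two (pt p₁ p₂ p₃) (pt u₁ u₂ u₃) (pt v₁ v₂ v₃) (pt w₁ w₂ w₃) x y b c =
  solvePt 16 (λ p₁ p₂ p₃ u₁ u₂ u₃ v₁ v₂ v₃ w₁ w₂ w₃ x y b c →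
    let p = ptᴱ p₁ p₂ p₃; u = ptᴱ u₁ u₂ u₃; v = ptᴱ v₁ v₂ v₃; w = ptᴱ w₁ w₂ w₃
        O = appᴱ (colsᴱ u v w) (ptᴱ (x *ᴱ Κ (+ 2) +ᴱ -ᴱ Κ 1ℤ) (y *ᴱ Κ (+ 2) +ᴱ -ᴱ Κ 1ℤ) (Κ (+ 2))) ⊕ᴱ p in
    (appᴱ (colsᴱ ((Κ 1ℤ +ᴱ -ᴱ x) ·ᴱ u ⊕ᴱ (-ᴱ y) ·ᴱ v ⊕ᴱ Κ -1ℤ ·ᴱ w) v u) (ptᴱ (Κ (+ 2)) b c) ⊕ᴱ O ,
     p ⊕ᴱ (Κ 1ℤ +ᴱ c) ·ᴱ u ⊕ᴱ (b +ᴱ -ᴱ Κ 1ℤ) ·ᴱ v))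
    refl p₁ p₂ p₃ u₁ u₂ u₃ v₁ v₂ v₃ w₁ w₂ w₃ x y b c

U2-frame-vertices : ∀ (p u v w : Pt) (x y : ℤ) →
  map (affine (U2-frame u v w x y) (affine (cols u v w) p (pt (x * + 2 - 1ℤ) (y * + 2 - 1ℤ) (+ 2))))
      (U2-A ∷ U2-B ∷ U2-C ∷ [])
    ≡ map (aff2 p u v) (T-a ∷ T-c ∷ T-b ∷ [])
U2-frame-vertices p u v w x y =
  cong₂ _∷_ (U2-frame-level-two p u v w x y 1ℤ 1ℤ)
    (cong₂ _∷_ (U2-frame-level-two p u v w x y (+ 2) (- 1ℤ))
      (cong₂ _∷_ (U2-frame-level-two p u v w x y 0ℤ (- 1ℤ)) refl))

record OrientedNormal (O A B C : Pt) (l : ℕ) : Set where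
  field
    n w     : Pt
    m       : ℕ
    0<m     : 0 <ℕ m
    n≢0     : n ≢ origin
    n⊥AB    : dot n (B ⊖ A) ≡ 0ℤ
    n⊥AC    : dot n (C ⊖ A) ≡ 0ℤ
    minimal : ∀ x → 0 <ℕ ∣ dot n (x ⊖ A) ∣ → m ≤ℕ ∣ dot n (x ⊖ A) ∣
    n·w≡m   : dot n w ≡ + m
    apex    : dot n (O ⊖ A) ≡ + (l *ℕ m)

orient : ∀ {O A B C : Pt} {l : ℕ} → IntDist O A B C l → OrientedNormal O A B C l
orient {O} {A} {B} {C} {l} (n , n≢0 , n⊥AB , n⊥AC , m , 0<m , (x₀ , ∣x₀∣≡m) , minimal , ∣apex∣≡lm) = record
  { n       = σ · n
  ; w       = τ · (x₀ ⊖ A)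
  ; m       = m
  ; 0<m     = 0<m
  ; n≢0     = λ σn≡0 → σ≢0 (·≡origin⇒≡0 n≢0 σn≡0)
  ; n⊥AB    = keeps-zero n⊥AB
  ; n⊥AC    = keeps-zero n⊥AC
  ; minimal = λ x → subst (λ h → 0 <ℕ h → m ≤ℕ h) (sym (keeps-abs (x ⊖ A))) (minimal x)
  ; n·w≡m   = ≡-trans (dot-·ʳ τ (σ · n) (x₀ ⊖ A))
                (≡-trans τ-orients (cong +_ (≡-trans (keeps-abs (x₀ ⊖ A)) ∣x₀∣≡m)))
  ; apex    = ≡-trans (dot-·ˡ σ n (O ⊖ A)) (≡-trans σ-orients (cong +_ ∣apex∣≡lm))
  }
  where
  σ τ : ℤ
  σ = proj₁ (sign-of (dot n (O ⊖ A)))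
  τ = proj₁ (sign-of (dot (σ · n) (x₀ ⊖ A)))
  ∣σ∣≡1 : ∣ σ ∣ ≡ 1
  ∣σ∣≡1 = proj₁ (proj₂ (sign-of (dot n (O ⊖ A))))
  σ-orients : σ * dot n (O ⊖ A) ≡ + ∣ dot n (O ⊖ A) ∣
  σ-orients = proj₂ (proj₂ (sign-of (dot n (O ⊖ A))))
  τ-orients : τ * dot (σ · n) (x₀ ⊖ A) ≡ + ∣ dot (σ · n) (x₀ ⊖ A) ∣
  τ-orients = proj₂ (proj₂ (sign-of (dot (σ · n) (x₀ ⊖ A))))
  σ≢0 : σ ≢ 0ℤ
  σ≢0 σ≡0 = ℕ.0≢1+n (≡-trans (sym (cong ∣_∣ σ≡0)) ∣σ∣≡1)
  keeps-zero : ∀ {x} → dot n x ≡ 0ℤ → dot (σ · n) x ≡ 0ℤ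
  keeps-zero {x} n⊥x = ≡-trans (dot-·ˡ σ n x) (≡-trans (cong (σ *_) n⊥x) (ℤ.*-zeroʳ σ))
  keeps-abs : ∀ x → ∣ dot (σ · n) x ∣ ≡ ∣ dot n x ∣
  keeps-abs x = begin
    ∣ dot (σ · n) x ∣          ≡⟨ cong ∣_∣ (dot-·ˡ σ n x) ⟩
    ∣ σ * dot n x ∣            ≡⟨ ℤ.abs-* σ (dot n x) ⟩
    ∣ σ ∣ *ℕ ∣ dot n x ∣       ≡⟨ cong (_*ℕ ∣ dot n x ∣) ∣σ∣≡1 ⟩
    1 *ℕ ∣ dot n x ∣           ≡⟨ ℕ.*-identityˡ _ ⟩
    ∣ dot n x ∣                ∎
    where open ≡-Reasoning

-- Φ (s , t , k) = ψ (s , t) + k w, with ψ = aff2 p u v and w one lattice step above the base plane.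
module Frame {O A B C : Pt} {l : ℕ} (normal : OrientedNormal O A B C l) (p u v : Pt)
  (u×v≢0 : cross u v ≢ origin) (ABC≢0 : cross (B ⊖ A) (C ⊖ A) ≢ origin)
  (base : map (aff2 p u v) (T-a ∷ T-b ∷ T-c ∷ []) ↭ (A ∷ B ∷ C ∷ []))
  (onto-plane : ∀ x → InPlane A B C x → Σ Pt2 λ y → aff2 p u v y ≡ x)
  where

  open OrientedNormal normal
  open ≡-Reasoning

  instance
    m≢0 : NonZero m
    m≢0 = >-nonZero 0<m

  Φ : Pt → Pt
  Φ = affine (cols u v w) p

  on-base : ∀ {X} → X ∈ A ∷ B ∷ C ∷ [] → dot n (X ⊖ A) ≡ 0ℤ
  on-base (here refl)                 = dot-⊖-self n A
  on-base (there (here refl))         = n⊥AB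
  on-base (there (there (here refl))) = n⊥AC

  frame-flat : dot n (p ⊖ A) ≡ 0ℤ × dot n u ≡ 0ℤ × dot n v ≡ 0ℤ
  frame-flat = vanishing-on-reference-triangle
    (≡-trans (sym (height-aff2 n p u v A (+ 2) 0ℤ)) (on-base (∈-resp-↭ base (here refl))))
    (≡-trans (sym (height-aff2 n p u v A 0ℤ (- 1ℤ))) (on-base (∈-resp-↭ base (there (here refl)))))
    (≡-trans (sym (height-aff2 n p u v A 0ℤ 1ℤ)) (on-base (∈-resp-↭ base (there (there (here refl))))))

  u-flat : dot n u ≡ 0ℤ
  u-flat = proj₁ (proj₂ frame-flat)

  v-flat : dot n v ≡ 0ℤ
  v-flat = proj₂ (proj₂ frame-flat)

  height-Φ : ∀ (s t k : ℤ) → dot n (Φ (pt s t k) ⊖ A) ≡ k * + m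
  height-Φ s t k = begin
    dot n (Φ (pt s t k) ⊖ A)                                ≡⟨ cong (λ X → dot n (X ⊖ A)) (affine-cols p u v w s t k) ⟩
    dot n (aff2 p u v (pt2 s t) ⊕ k · w ⊖ A)                ≡⟨ height-combination n (aff2 p u v (pt2 s t)) w A k ⟩
    dot n (aff2 p u v (pt2 s t) ⊖ A) + k * dot n w          ≡⟨ cong₂ (λ h h′ → h + k * h′) (height-aff2 n p u v A s t) n·w≡m ⟩
    dot n (p ⊖ A) + s * dot n u + t * dot n v + k * + m
      ≡⟨ cong₂ (λ h h′ → h + s * h′ + t * dot n v + k * + m) (proj₁ frame-flat) u-flat ⟩
    0ℤ + s * 0ℤ + t * dot n v + k * + m                     ≡⟨ cong (λ h → 0ℤ + s * 0ℤ + t * h + k * + m) v-flat ⟩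
    0ℤ + s * 0ℤ + t * 0ℤ + k * + m                          ≡⟨ drop-zeros s t k (+ m) ⟩
    k * + m                                                 ∎
    where
    drop-zeros : ∀ (s t k M : ℤ) → 0ℤ + s * 0ℤ + t * 0ℤ + k * M ≡ k * M
    drop-zeros = solve-∀

  Φ-lift : ∀ (y : Pt2) → Φ (lift y) ≡ aff2 p u v y
  Φ-lift (pt2 s t) = ≡-trans (affine-cols p u v w s t 0ℤ) (⊕-zero-multiple (aff2 p u v (pt2 s t)) w)

  -- Division with remainder by m moves any integer point down into the base plane.
  Φ-onto : ∀ z → Σ Pt λ y → Φ y ≡ z
  Φ-onto z = pt (qx (proj₁ in-plane)) (qy (proj₁ in-plane)) k , (begin
    Φ (pt _ _ k)                                   ≡⟨ affine-cols p u v w _ _ k ⟩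
    aff2 p u v (proj₁ in-plane) ⊕ k · w            ≡⟨ cong (_⊕ k · w) (proj₂ in-plane) ⟩
    z ⊖ k · w ⊕ k · w                              ≡⟨ ⊖⊕-cancel z (k · w) ⟩
    z                                              ∎)
    where
    r k : ℤ
    r = dot n (z ⊖ A)
    k = r /ℕ m
    remainder : dot n (z ⊖ k · w ⊖ A) ≡ + (r %ℕ m)
    remainder = begin
      dot n (z ⊖ k · w ⊖ A)               ≡⟨ height-shift n z w A k ⟩
      r - k * dot n w                     ≡⟨ cong (λ h → r - k * h) n·w≡m ⟩
      r - k * + m                         ≡⟨ cong (_- k * + m) (a≡a%ℕn+[a/ℕn]*n r m) ⟩
      + (r %ℕ m) + k * + m - k * + m      ≡⟨ cancel (+ (r %ℕ m)) (k * + m) ⟩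
      + (r %ℕ m)                          ∎
      where
      cancel : ∀ (a b : ℤ) → a + b - b ≡ a
      cancel = solve-∀
    flat : dot n (z ⊖ k · w ⊖ A) ≡ 0ℤ
    flat = ≡-trans remainder (cong +_ (below-minimum (n%ℕd<d r m)
      (subst (λ h → 0 <ℕ h → m ≤ℕ h) (cong ∣_∣ remainder) (minimal (z ⊖ k · w)))))
    in-plane : Σ Pt2 λ y → aff2 p u v y ≡ z ⊖ k · w
    in-plane = onto-plane (z ⊖ k · w) (orthogonal⇒InPlane {A} {B} {C} {z ⊖ k · w} n n≢0 ABC≢0 n⊥AB n⊥AC flat)

  linear-onto : ∀ z → Σ Pt λ y → app (cols u v w) y ≡ z
  linear-onto z = proj₁ (Φ-onto (z ⊕ p)) , (begin
    app (cols u v w) (proj₁ (Φ-onto (z ⊕ p)))              ≡⟨ ⊕⊖-cancel _ p ⟨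
    Φ (proj₁ (Φ-onto (z ⊕ p))) ⊖ p                         ≡⟨ cong (_⊖ p) (proj₂ (Φ-onto (z ⊕ p))) ⟩
    z ⊕ p ⊖ p                                              ≡⟨ ⊕⊖-cancel z p ⟩
    z                                                      ∎)

  level-injective : ∀ {i k : ℕ} → + i * + m ≡ + k * + m → i ≡ k
  level-injective {i} {k} eq = ℤ.+-injective (ℤ.*-cancelʳ-≡ (+ i) (+ k) (+ m) eq)

  apex-height : dot n (O ⊖ A) ≡ + l * + m
  apex-height = ≡-trans apex (ℤ.pos-* l m)

  apex-level : ∀ {α β h : ℤ} → Φ (pt α β h) ≡ O → h ≡ + l
  apex-level {α} {β} {h} apex-eq = ℤ.*-cancelʳ-≡ h (+ l) (+ m) (begin
    h * + m                   ≡⟨ height-Φ α β h ⟨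
    dot n (Φ (pt α β h) ⊖ A)  ≡⟨ cong (λ X → dot n (X ⊖ A)) apex-eq ⟩
    dot n (O ⊖ A)             ≡⟨ apex-height ⟩
    + l * + m                 ∎)

  pyramid-image : ∀ {P : Pt} {α β : ℤ} → Φ (pt α β (+ l)) ≡ O →
    InConv4 P (pt α β (+ l)) (lift T-a) (lift T-b) (lift T-c) → InConv4 (Φ P) O A B C
  pyramid-image apex-eq inside =
    InConv4-resp-↭ base (InConv4-affine (cols u v w) p apex-eq (Φ-lift T-a) (Φ-lift T-b) (Φ-lift T-c) inside)

  no-mid-level-point : CompletelyEmpty O A B C → ∀ {α β : ℤ} → Φ (pt α β (+ l)) ≡ O → ¬ MidLevelPoint l α β
  no-mid-level-point empty apex-eq (mid-level j 0<j j<l x y inside) =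
    [ not-apex , not-in-base ]′ (empty (Φ (pt x y (+ j))) (pyramid-image apex-eq inside))
    where
    not-apex : Φ (pt x y (+ j)) ≢ O
    not-apex P≡O = ℕ.<-irrefl (level-injective (begin
      + j * + m                          ≡⟨ height-Φ x y (+ j) ⟨
      dot n (Φ (pt x y (+ j)) ⊖ A)       ≡⟨ cong (λ X → dot n (X ⊖ A)) P≡O ⟩
      dot n (O ⊖ A)                      ≡⟨ apex-height ⟩
      + l * + m                          ∎)) j<l
    not-in-base : ¬ InConv3 (Φ (pt x y (+ j))) A B C
    not-in-base in-base = ℕ.<-irrefl (sym (level-injective (begin
      + j * + m                          ≡⟨ height-Φ x y (+ j) ⟨
      dot n (Φ (pt x y (+ j)) ⊖ A)       ≡⟨ InConv3-orthogonal n n⊥AB n⊥AC in-base ⟩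
      0ℤ                                 ∎))) 0<j

  U2-equivalence : ∀ {x y : ℤ} → Φ (pt (x * + 2 - 1ℤ) (y * + 2 - 1ℤ) (+ 2)) ≡ O →
    PyrEquiv O A B C U2-O U2-A U2-B U2-C
  U2-equivalence {x} {y} apex-eq =
    PyrEquiv-inverse F (proj₁ inverse) O (proj₁ (proj₂ inverse)) (proj₂ (proj₂ inverse)) (affine-origin F O)
      (subst (λ X → map (affine F X) (U2-A ∷ U2-B ∷ U2-C ∷ []) ↭ (A ∷ B ∷ C ∷ [])) apex-eq
        (subst (_↭ (A ∷ B ∷ C ∷ [])) (sym (U2-frame-vertices p u v w x y)) (trans (prep _ (swap _ _ refl)) base)))
    where
    F : Mat
    F = U2-frame u v w x y
    first-column : dot n ((1ℤ - x) · u ⊕ - y · v ⊕ -1ℤ · w) ≡ - + m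
    first-column = begin
      dot n ((1ℤ - x) · u ⊕ - y · v ⊕ -1ℤ · w)                ≡⟨ dot-combination n u v w (1ℤ - x) (- y) -1ℤ ⟩
      (1ℤ - x) * dot n u + - y * dot n v + -1ℤ * dot n w      ≡⟨ cong₂ (λ h h′ → (1ℤ - x) * h + - y * h′ + -1ℤ * dot n w) u-flat v-flat ⟩
      (1ℤ - x) * 0ℤ + - y * 0ℤ + -1ℤ * dot n w                ≡⟨ cong (λ h → (1ℤ - x) * 0ℤ + - y * 0ℤ + -1ℤ * h) n·w≡m ⟩
      (1ℤ - x) * 0ℤ + - y * 0ℤ + -1ℤ * + m                    ≡⟨ drop-zeros (1ℤ - x) (- y) (+ m) ⟩
      - + m                                                   ∎
      where
      drop-zeros : ∀ (a b M : ℤ) → a * 0ℤ + b * 0ℤ + -1ℤ * M ≡ - M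
      drop-zeros = solve-∀
    first-column≢0 : dot n ((1ℤ - x) · u ⊕ - y · v ⊕ -1ℤ · w) ≢ 0ℤ
    first-column≢0 eq = ℕ.<-irrefl (sym (ℤ.+-injective (ℤ.neg-injective (≡-trans (sym first-column) eq)))) 0<m
    v×u≢0 : cross v u ≢ origin
    v×u≢0 eq = -1≢0 (·≡origin⇒≡0 { -1ℤ} u×v≢0 (≡-trans (sym (cross-antisym u v)) eq))
      where
      -1≢0 : -1ℤ ≢ 0ℤ
      -1≢0 ()
    F-onto : ∀ z → Σ Pt λ Y → app F Y ≡ z
    F-onto z = pt (- k) (t - k * y) (s + k * (1ℤ - x)) ,
      ≡-trans (U2-frame-onto u v w x y s t k) (proj₂ (linear-onto z))
      where
      s t k : ℤ
      s = px (proj₁ (linear-onto z))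
      t = py (proj₁ (linear-onto z))
      k = pz (proj₁ (linear-onto z))
    inverse : Σ Mat λ M → (∀ X → app M (app F X) ≡ X) × (∀ X → app F (app M X) ≡ X)
    inverse = bijective⇒inverse F (cols-injective {n} first-column≢0 v-flat u-flat v×u≢0) F-onto

  apex-coordinates : Σ ℤ λ α → Σ ℤ λ β → Φ (pt α β (+ l)) ≡ O
  apex-coordinates = px Y , py Y ,
    subst (λ h → Φ (pt (px Y) (py Y) h) ≡ O) (apex-level {px Y} {py Y} {pz Y} (proj₂ (Φ-onto O))) (proj₂ (Φ-onto O))
    where
    Y : Pt
    Y = proj₁ (Φ-onto O)

  two-story : CompletelyEmpty O A B C → 2 ≤ℕ l → (l ≡ 2) × PyrEquiv O A B C U2-O U2-A U2-B U2-C
  two-story empty 2≤l =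
    [ (λ mid → ⊥-elim (no-mid-level-point empty apex-eq mid)) , equivalent ]′ (mid-level-point-or-odd l 2≤l α β)
    where
    α β : ℤ
    α = proj₁ apex-coordinates
    β = proj₁ (proj₂ apex-coordinates)
    apex-eq : Φ (pt α β (+ l)) ≡ O
    apex-eq = proj₂ (proj₂ apex-coordinates)
    equivalent : l ≡ 2 × Odd α × Odd β → (l ≡ 2) × PyrEquiv O A B C U2-O U2-A U2-B U2-C
    equivalent (l≡2 , (x , α≡) , (y , β≡)) =
      l≡2 , U2-equivalence {x} {y} (subst (λ P → Φ P ≡ O) (cong-pt α≡ β≡ (cong +_ l≡2)) apex-eq)

mainTheorem15 : (O A B C : Pt) → IsPyramid O A B C → Multistory O A B C →
    CompletelyEmpty O A B C → TriEquiv A B C T-a T-b T-c →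
    IntDist O A B C 2 × PyrEquiv O A B C U2-O U2-A U2-B U2-C
mainTheorem15 O A B C pyramid (l , 1<l , distance) empty (p , u , v , u×v≢0 , base , onto-plane) =
  subst (IntDist O A B C) (proj₁ classification) distance , proj₂ classification
  where
  classification : (l ≡ 2) × PyrEquiv O A B C U2-O U2-A U2-B U2-C
  classification =
    Frame.two-story (orient distance) p u v u×v≢0 (nondegenerate {O} {A} {B} {C} pyramid) base onto-plane empty 1<l
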